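{- Let $n>r>0$ be integers and $b=(b_1,\dots,b_r)\in(\mathbb{N}^*)^r$ with $b_1+\cdots+b_r=n$. Let $c_j=\sum_{k=1}^{j}b_k$ for $j\in[r]$ and $\mathcal{A}_b=\{c_1,\dots,c_r\}\subseteq[n]$ (so $c_r=n$). Let $\mathcal{C}$ be the set of all pairs $(\mathcal{S},\theta)$ where $\mathcal{S}$ is a nonempty subset of $[n]$ and $\theta=(\theta_1,\dots,\theta_n)\in\mathcal{S}^n$ satisfies: $\theta_n=\max\mathcal{S}$, and for every $c_j\in\mathcal{A}_b$, $\theta_{c_j}\ge\theta_k$ for all $k<c_j$ and $\theta_{c_j}<\theta_k$ for all $k>c_j$. Define $wt(\mathcal{S},\theta)=(-1)^{|\mathcal{S}|}$. Then $$\sum_{s=r}^{n}(-1)^s\binom{n}{s}\sum_{\substack{a_1+\cdots+a_r=s\\ a_i\in\mathbb{N}^*}}a_1^{b_1-1}\cdots a_r^{b_r-1}=\sum_{(\mathcal{S},\theta)\in\mathcal{C}}wt(\mathcal{S},\theta).$$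
   Context: $\mathbb{N}^*$ denotes the set of positive integers and $[n]=\{1,\dots,n\}$. -}

module Defs where

open import Data.Bool using (Bool; true; false; if_then_else_)
open import Data.Nat as ℕ using (ℕ; zero; suc; _∸_; _^_)
import Data.Nat.Properties as ℕP
open import Data.Nat.Combinatorics using (_C_)
open import Data.Nat.ListAction using (sum; product)
open import Data.Integer as ℤ using (ℤ; +_; -_)
open import Data.Fin using (Fin; toℕ) renaming (_≤_ to _≤ᶠ_; _<_ to _<ᶠ_)
open import Data.Fin.Properties using (all?; any?; _≟_; _≤?_; _<?_)
open import Data.Fin.Subset using (Subset; _∈_; Nonempty; ∣_∣)
open import Data.Fin.Subset.Properties using (_∈?_; nonempty?)
open import Data.List as List using (List; []; _∷_; map; concatMap; filter; allFin; upTo)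
open import Data.Vec as Vec using (Vec; lookup)
open import Data.Product using (_×_; _,_; ∃; proj₁; proj₂)
open import Relation.Binary.PropositionalEquality using (_≡_)
open import Relation.Nullary using (Dec; yes; no; does; ¬_)
open import Relation.Nullary.Decidable using (_×-dec_; _→-dec_)

vecsFrom : {A : Set} → List A → (r : ℕ) → List (Vec A r)
vecsFrom xs zero    = Vec.[] ∷ []
vecsFrom xs (suc r) = concatMap (λ x → map (x Vec.∷_) (vecsFrom xs r)) xs

sumℤ : List ℤ → ℤ
sumℤ = List.foldr ℤ._+_ (+ 0)

sumWhere : {A : Set} {P : A → Set} → ((x : A) → Dec (P x)) → (A → ℤ) → List A → ℤ
sumWhere P? f xs = sumℤ (map f (filter P? xs))

sgn : ℕ → ℤ
sgn zero    = + 1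
sgn (suc k) = - sgn k

-- The data: b : Fin r → ℕ, indices of [n] are represented by Fin n
-- (the Fin element i stands for the integer i+1).

c : {r : ℕ} → (Fin r → ℕ) → Fin r → ℕ
c {r} b j = sum (map b (filter (λ k → k ≤? j) (allFin r)))

InA : {r : ℕ} → (Fin r → ℕ) → {n : ℕ} → Fin n → Set
InA {r} b p = ∃ λ (j : Fin r) → suc (toℕ p) ≡ c b j

InA? : {r : ℕ} (b : Fin r → ℕ) {n : ℕ} (p : Fin n) → Dec (InA b p)
InA? b p = any? (λ j → suc (toℕ p) ℕP.≟ c b j)

IsMax : {n : ℕ} → Subset n → Fin n → Set
IsMax S x = x ∈ S × (∀ y → y ∈ S → y ≤ᶠ x)

IsMax? : {n : ℕ} (S : Subset n) (x : Fin n) → Dec (IsMax S x)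
IsMax? S x = (x ∈? S) ×-dec all? (λ y → (y ∈? S) →-dec (y ≤? x))

InC : (n : ℕ) {r : ℕ} → (Fin r → ℕ) → Subset n × Vec (Fin n) n → Set
InC n b (S , θ) =
  Nonempty S ×
  (∀ k → lookup θ k ∈ S) ×
  (∀ p → suc (toℕ p) ≡ n → IsMax S (lookup θ p)) ×
  (∀ p → InA b p →
     (∀ k → k <ᶠ p → lookup θ k ≤ᶠ lookup θ p) ×
     (∀ k → p <ᶠ k → lookup θ p <ᶠ lookup θ k))

InC? : (n : ℕ) {r : ℕ} (b : Fin r → ℕ) (x : Subset n × Vec (Fin n) n) → Dec (InC n b x)
InC? n b (S , θ) =
  nonempty? S ×-dec
  (all? (λ k → lookup θ k ∈? S) ×-dec
  (all? (λ p → (suc (toℕ p) ℕP.≟ n) →-dec IsMax? S (lookup θ p)) ×-dec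
  all? (λ p → InA? b p →-dec
     (all? (λ k → (k <? p) →-dec (lookup θ k ≤? lookup θ p)) ×-dec
      all? (λ k → (p <? k) →-dec (lookup θ p <? lookup θ k))))))

pairs : (n : ℕ) → List (Subset n × Vec (Fin n) n)
pairs n = concatMap (λ S → map (S ,_) (vecsFrom (allFin n) n)) (vecsFrom (true ∷ false ∷ []) n)

wt : {n : ℕ} → Subset n × Vec (Fin n) n → ℤ
wt (S , θ) = sgn ∣ S ∣

RHS : (n : ℕ) {r : ℕ} → (Fin r → ℕ) → ℤ
RHS n b = sumWhere (InC? n b) wt (pairs n)

oneTo : ℕ → List ℕ
oneTo s = map suc (upTo s)

-- Σ_{a_1+...+a_r = s, a_i ≥ 1} a_1^{b_1-1} ⋯ a_r^{b_r-1}
-- (each a_i ≤ s automatically, so enumerating a ∈ [1..s]^r is exhaustive)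
compSum : (s : ℕ) {r : ℕ} → (Fin r → ℕ) → ℤ
compSum s {r} b =
  sumWhere (λ a → Vec.sum a ℕP.≟ s)
           (λ a → + product (map (λ k → lookup a k ^ (b k ∸ 1)) (allFin r)))
           (vecsFrom (oneTo s) r)

LHS : (n : ℕ) {r : ℕ} → (Fin r → ℕ) → ℤ
LHS n {r} b = sumℤ (map (λ s → sgn s ℤ.* (+ (n C s)) ℤ.* compSum s b) (List.map (r ℕ.+_) (upTo (suc (n ∸ r)))))

-- Both sides vanish.
--
-- Left: compSum s b is the convolution over i of the sequences s ↦ s^(b_i - 1) (for s ≥ 1, and 0 at
-- s = 0). Each factor is a polynomial of degree < b_i except at 0, so the convolution is a polynomial
-- of degree < b_1 + ⋯ + b_r = n except at 0, where the defect is a product of factors 0^(b_i - 1); it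
-- vanishes because r < n forces some b_i ≥ 2. The alternating binomial sum of order n annihilates
-- polynomials of degree < n, and the terms s < r that the left-hand side omits are zero anyway.
--
-- Right: since n ∈ A_b and |A_b| = r < n, there are positions p = q + 1 with p ∈ A_b, q ∉ A_b.
-- A sign-reversing involution on 𝒞 changes |S| by one: if some value below max S is missed by θ,
-- toggle it in S; otherwise S = {1, …, θ_n}, and θ is modified at p: if θ_p is already taken before
-- p, then θ_p and all larger values move up by one, else all values ≥ θ_p move down by one, and S
-- becomes the new down-set.

module Submission where

open import Defs
open import Data.Nat using (ℕ; _<_; _≤_)
open import Data.Fin using (Fin)
open import Data.List using (map; allFin)
open import Data.Nat.ListAction using (sum)
open import Relation.Binary.PropositionalEquality using (_≡_)

open import Data.Bool using (Bool; true; false; not; _∧_)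
import Data.Bool.Properties as BP
open import Data.Nat as ℕ using (zero; suc; _∸_; _^_; z≤n; s≤s)
import Data.Nat.Properties as ℕP
open import Data.Nat.ListAction using (product)
open import Data.Nat.Combinatorics using (_C_; nCk+nC[k+1]≡[n+1]C[k+1]; nCk≡nC[n∸k]; nCn≡1)
open import Data.Nat.Combinatorics.Specification using (k>n⇒nCk≡0)
open import Data.Integer as ℤ using (ℤ; +_; -_; _+_; _*_; _-_)
import Data.Integer.Properties as ℤP
open import Algebra.Properties.CommutativeSemigroup ℤP.+-commutativeSemigroup using (interchange)
open import Data.Integer.Tactic.RingSolver using (solve-∀)
open import Data.Fin as F using (toℕ; fromℕ; fromℕ<; punchOut) renaming (zero to fz; suc to fs)
import Data.Fin.Properties as FP
open import Data.Fin.Subset using (Subset; _∈_; ∣_∣)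
open import Data.List using (List; []; _∷_; concatMap; filter; _++_; applyUpTo; upTo)
import Data.List.Properties as LP
import Data.List.Relation.Unary.All.Properties as AllP
open import Data.Vec as Vec using (Vec; lookup; tabulate; _∷_; [])
import Data.Vec.Properties as VP
open import Data.Product using (_×_; _,_; ∃; ∃₂; proj₁; proj₂; map₂)
open import Data.Product.Properties using (×-≡,≡→≡; ×-≡,≡←≡)
open import Data.Empty using (⊥-elim; ⊥)
open import Relation.Binary.PropositionalEquality using (refl; sym; trans; cong; cong₂; subst; subst₂; _≢_; module ≡-Reasoning)
open import Relation.Binary.Definitions using (DecidableEquality; tri<; tri≈; tri>)
open import Relation.Nullary using (Dec; yes; no; does; ¬_)
open import Relation.Nullary.Decidable using (_×-dec_; ¬?; map′; dec-true; dec-false; dec-no; does-⇔)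
open import Function using (_∘_; _⇔_; mk⇔)

∑ : {A : Set} → List A → (A → ℤ) → ℤ
∑ [] f = + 0
∑ (x ∷ xs) f = f x + ∑ xs f

sumℤ-map : {A : Set} (xs : List A) (f : A → ℤ) → sumℤ (map f xs) ≡ ∑ xs f
sumℤ-map [] f = refl
sumℤ-map (x ∷ xs) f = cong (_+_ (f x)) (sumℤ-map xs f)

when : Bool → ℤ → ℤ
when true z = z
when false z = + 0

sumWhere≡∑-when : {A : Set} {P : A → Set} (P? : (x : A) → Dec (P x)) (f : A → ℤ) (xs : List A) →
                  sumWhere P? f xs ≡ ∑ xs (λ x → when (does (P? x)) (f x))
sumWhere≡∑-when P? f [] = refl
sumWhere≡∑-when P? f (x ∷ xs) with does (P? x)
... | true = cong (_+_ (f x)) (sumWhere≡∑-when P? f xs)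
... | false = trans (sumWhere≡∑-when P? f xs) (sym (ℤP.+-identityˡ _))

∑-cong : {A : Set} (xs : List A) {f g : A → ℤ} → (∀ x → f x ≡ g x) → ∑ xs f ≡ ∑ xs g
∑-cong [] e = refl
∑-cong (x ∷ xs) e = cong₂ _+_ (e x) (∑-cong xs e)

∑-++ : {A : Set} (xs ys : List A) (f : A → ℤ) → ∑ (xs ++ ys) f ≡ ∑ xs f + ∑ ys f
∑-++ [] ys f = sym (ℤP.+-identityˡ _)
∑-++ (x ∷ xs) ys f = trans (cong (_+_ (f x)) (∑-++ xs ys f)) (sym (ℤP.+-assoc (f x) _ _))

∑-map : {A B : Set} (h : A → B) (xs : List A) (f : B → ℤ) → ∑ (map h xs) f ≡ ∑ xs (f ∘ h)
∑-map h [] f = refl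
∑-map h (x ∷ xs) f = cong (_+_ (f (h x))) (∑-map h xs f)

∑-concatMap : {A B : Set} (h : A → List B) (xs : List A) (f : B → ℤ) →
              ∑ (concatMap h xs) f ≡ ∑ xs (λ x → ∑ (h x) f)
∑-concatMap h [] f = refl
∑-concatMap h (x ∷ xs) f = trans (∑-++ (h x) (concatMap h xs) f) (cong (_+_ (∑ (h x) f)) (∑-concatMap h xs f))

*-distribˡ-minus : ∀ c a b → c * (a - b) ≡ c * a - c * b
*-distribˡ-minus = solve-∀

∑-+ : {A : Set} (xs : List A) (f g : A → ℤ) → ∑ xs (λ x → f x + g x) ≡ ∑ xs f + ∑ xs g
∑-+ [] f g = refl
∑-+ (x ∷ xs) f g = trans (cong (_+_ (f x + g x)) (∑-+ xs f g)) (interchange (f x) (g x) _ _)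

∑-* : {A : Set} (xs : List A) (c : ℤ) (f : A → ℤ) → ∑ xs (λ x → c * f x) ≡ c * ∑ xs f
∑-* [] c f = sym (ℤP.*-zeroʳ c)
∑-* (x ∷ xs) c f = trans (cong (_+_ (c * f x)) (∑-* xs c f)) (sym (ℤP.*-distribˡ-+ c (f x) _))

∑-zero : {A : Set} (xs : List A) (f : A → ℤ) → (∀ x → f x ≡ + 0) → ∑ xs f ≡ + 0
∑-zero [] f e = refl
∑-zero (x ∷ xs) f e = cong₂ _+_ (e x) (∑-zero xs f e)

∑-swap : {A B : Set} (xs : List A) (ys : List B) (f : A → B → ℤ) →
         ∑ xs (λ x → ∑ ys (f x)) ≡ ∑ ys (λ y → ∑ xs (λ x → f x y))
∑-swap [] ys f = sym (∑-zero ys _ (λ _ → refl))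
∑-swap (x ∷ xs) ys f = trans (cong (_+_ (∑ ys (f x))) (∑-swap xs ys f)) (sym (∑-+ ys (f x) _))

∑-neg : {A : Set} (xs : List A) (f : A → ℤ) → ∑ xs (λ x → - f x) ≡ - ∑ xs f
∑-neg [] f = refl
∑-neg (x ∷ xs) f = trans (cong (_+_ (- f x)) (∑-neg xs f)) (sym (ℤP.neg-distrib-+ (f x) _))

∑-when : {A : Set} (xs : List A) (c : Bool) (f : A → ℤ) → ∑ xs (λ x → when c (f x)) ≡ when c (∑ xs f)
∑-when xs true f = refl
∑-when xs false f = ∑-zero xs _ (λ _ → refl)

when-* : ∀ c x y → when c (x * y) ≡ x * when c y
when-* true x y = refl
when-* false x y = sym (ℤP.*-zeroʳ x)

when-∧ : ∀ a b z → when (a ∧ b) z ≡ when a (when b z)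
when-∧ true b z = refl
when-∧ false b z = refl

when-yes : {P : Set} (P? : Dec P) {y : ℤ} → P → when (does P?) y ≡ y
when-yes P? p rewrite dec-true P? p = refl

when-no : {P : Set} (P? : Dec P) {y : ℤ} → ¬ P → when (does P?) y ≡ + 0
when-no P? ¬p rewrite dec-false P? ¬p = refl

when-cong : {P : Set} (P? : Dec P) {y z : ℤ} → (P → y ≡ z) → when (does P?) y ≡ when (does P?) z
when-cong (yes p) e = e p
when-cong (no _) e = refl

∑< : ℕ → (ℕ → ℤ) → ℤ
∑< zero f = + 0
∑< (suc n) f = f 0 + ∑< n (f ∘ suc)

∑<-cong : ∀ n {f g : ℕ → ℤ} → (∀ i → i ℕ.< n → f i ≡ g i) → ∑< n f ≡ ∑< n g
∑<-cong zero e = refl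
∑<-cong (suc n) e = cong₂ _+_ (e 0 (s≤s z≤n)) (∑<-cong n (λ i i<n → e (suc i) (s≤s i<n)))

∑<-+ : ∀ n (f g : ℕ → ℤ) → ∑< n (λ x → f x + g x) ≡ ∑< n f + ∑< n g
∑<-+ zero f g = refl
∑<-+ (suc n) f g = trans (cong (_+_ (f 0 + g 0)) (∑<-+ n (f ∘ suc) (g ∘ suc))) (interchange (f 0) (g 0) _ _)

∑<-* : ∀ n (c : ℤ) (f : ℕ → ℤ) → ∑< n (λ x → c * f x) ≡ c * ∑< n f
∑<-* zero c f = sym (ℤP.*-zeroʳ c)
∑<-* (suc n) c f = trans (cong (_+_ (c * f 0)) (∑<-* n c (f ∘ suc))) (sym (ℤP.*-distribˡ-+ c (f 0) _))

∑<-zero : ∀ n (f : ℕ → ℤ) → (∀ i → i ℕ.< n → f i ≡ + 0) → ∑< n f ≡ + 0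
∑<-zero zero f e = refl
∑<-zero (suc n) f e = cong₂ _+_ (e 0 (s≤s z≤n)) (∑<-zero n (f ∘ suc) (λ i i<n → e (suc i) (s≤s i<n)))

∑<-snoc : ∀ n (f : ℕ → ℤ) → ∑< (suc n) f ≡ ∑< n f + f n
∑<-snoc zero f = ℤP.+-comm (f 0) (+ 0)
∑<-snoc (suc n) f = trans (cong (_+_ (f 0)) (∑<-snoc n (f ∘ suc))) (sym (ℤP.+-assoc (f 0) _ _))

∑<-split : ∀ a b (f : ℕ → ℤ) → ∑< (a ℕ.+ b) f ≡ ∑< a f + ∑< b (λ i → f (a ℕ.+ i))
∑<-split zero b f = sym (ℤP.+-identityˡ _)
∑<-split (suc a) b f = trans (cong (_+_ (f 0)) (∑<-split a b (f ∘ suc))) (sym (ℤP.+-assoc (f 0) _ _))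

∑-applyUpTo : ∀ (h : ℕ → ℕ) n (f : ℕ → ℤ) → ∑ (applyUpTo h n) f ≡ ∑< n (f ∘ h)
∑-applyUpTo h zero f = refl
∑-applyUpTo h (suc n) f = cong (_+_ (f (h 0))) (∑-applyUpTo (h ∘ suc) n f)

∑<-neg : ∀ n (f : ℕ → ℤ) → ∑< n (λ s → - f s) ≡ - ∑< n f
∑<-neg zero f = refl
∑<-neg (suc n) f = trans (cong (_+_ (- f 0)) (∑<-neg n (f ∘ suc))) (sym (ℤP.neg-distrib-+ (f 0) _))

∑<-minus : ∀ n (f g : ℕ → ℤ) → ∑< n f - ∑< n g ≡ ∑< n (λ x → f x - g x)
∑<-minus zero f g = refl
∑<-minus (suc n) f g = trans (regroup (f 0) (∑< n (f ∘ suc)) (g 0) (∑< n (g ∘ suc)))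
                         (cong (_+_ (f 0 - g 0)) (∑<-minus n (f ∘ suc) (g ∘ suc)))
  where regroup : ∀ a b c d → (a + b) - (c + d) ≡ (a - c) + (b - d)
        regroup = solve-∀

∑<-truncate : ∀ m t (G : ℕ → ℤ) → t ℕ.≤ m → ∑< m (λ i → when (does (suc i ℕ.≤? t)) (G i)) ≡ ∑< t G
∑<-truncate m zero G _ = ∑<-zero m _ (λ _ _ → refl)
∑<-truncate (suc m) (suc t) G (s≤s t≤m) = cong (_+_ (G 0)) (∑<-truncate m t (G ∘ suc) t≤m)

Δ : (ℕ → ℤ) → ℕ → ℤ
Δ f s = f (suc s) - f s

Poly< : ℕ → (ℕ → ℤ) → Set
Poly< zero f = ∀ s → f s ≡ + 0
Poly< (suc d) f = Poly< d (Δ f)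

Poly<-cong : ∀ d {f g : ℕ → ℤ} → (∀ s → f s ≡ g s) → Poly< d f → Poly< d g
Poly<-cong zero e pf s = trans (sym (e s)) (pf s)
Poly<-cong (suc d) e pf = Poly<-cong d (λ s → cong₂ _-_ (e (suc s)) (e s)) pf

Poly<-shift : ∀ d {f} → Poly< d f → Poly< d (f ∘ suc)
Poly<-shift zero pf s = pf (suc s)
Poly<-shift (suc d) pf = Poly<-shift d pf

Poly<-suc : ∀ d {f} → Poly< d f → Poly< (suc d) f
Poly<-suc zero pf s = cong₂ _-_ (pf (suc s)) (pf s)
Poly<-suc (suc d) pf = Poly<-suc d pf

Poly<-mono : ∀ {d e f} → d ℕ.≤ e → Poly< d f → Poly< e f
Poly<-mono {e = e} z≤n pf = Poly<-cong e (λ s → sym (pf s)) (zero-poly e)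
  where zero-poly : ∀ e → Poly< e (λ _ → + 0)
        zero-poly zero s = refl
        zero-poly (suc e) = zero-poly e
Poly<-mono (s≤s d≤e) pf = Poly<-mono d≤e pf

Poly<-+ : ∀ d {f g} → Poly< d f → Poly< d g → Poly< d (λ s → f s + g s)
Poly<-+ zero pf pg s = cong₂ _+_ (pf s) (pg s)
Poly<-+ (suc d) {f} {g} pf pg = Poly<-cong d (λ s → Δ-+ (f (suc s)) (f s) (g (suc s)) (g s)) (Poly<-+ d pf pg)
  where Δ-+ : ∀ a b c e → (a - b) + (c - e) ≡ (a + c) - (b + e)
        Δ-+ = solve-∀

Poly<-* : ∀ d (c : ℤ) {f} → Poly< d f → Poly< d (λ s → c * f s)
Poly<-* zero c pf s = trans (cong (c *_) (pf s)) (ℤP.*-zeroʳ c)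
Poly<-* (suc d) c {f} pf = Poly<-cong d (λ s → *-distribˡ-minus c (f (suc s)) (f s)) (Poly<-* d c pf)

Δ-id* : ∀ f s → + s * Δ f s + f (suc s) ≡ Δ (λ a → + a * f a) s
Δ-id* f s = trans (expand (+ s) (f (suc s)) (f s)) (cong (λ u → u * f (suc s) - + s * f s) (sym (ℤP.pos-+ 1 s)))
  where expand : ∀ t a b → t * (a - b) + a ≡ (+ 1 + t) * a - t * b
        expand = solve-∀

Poly<-id* : ∀ d {f} → Poly< d f → Poly< (suc d) (λ a → + a * f a)
Poly<-id* zero pf = Poly<-suc zero (λ s → trans (cong (+ s *_) (pf s)) (ℤP.*-zeroʳ (+ s)))
Poly<-id* (suc d) {f} pf = Poly<-cong (suc d) (Δ-id* f)
  (Poly<-+ (suc d) {λ s → + s * Δ f s} {f ∘ suc} (Poly<-id* d {Δ f} pf) (Poly<-shift (suc d) {f} pf))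

Poly<-pow : ∀ k → Poly< (suc k) (λ a → + (a ^ k))
Poly<-pow zero s = refl
Poly<-pow (suc k) = Poly<-cong (suc (suc k)) (λ a → sym (ℤP.pos-* a (a ^ k))) (Poly<-id* (suc k) {λ a → + (a ^ k)} (Poly<-pow k))

_⋆_ : (ℕ → ℤ) → (ℕ → ℤ) → ℕ → ℤ
(f ⋆ g) s = ∑< (suc s) (λ a → f a * g (s ∸ a))

⋆-suc : ∀ f g s → (f ⋆ g) (suc s) ≡ ∑< (suc s) (λ a → f a * g (suc (s ∸ a))) + f (suc s) * g 0
⋆-suc f g s = trans (∑<-snoc (suc s) (λ a → f a * g (suc s ∸ a)))
  (cong₂ _+_ (∑<-cong (suc s) (λ a a≤s → cong (λ t → f a * g t) (ℕP.+-∸-assoc 1 (ℕP.<⇒≤pred a≤s))))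
             (cong (λ t → f (suc s) * g t) (ℕP.n∸n≡0 s)))

Δ-⋆ : ∀ f g s → Δ (f ⋆ g) s ≡ f (suc s) * g 0 + (f ⋆ Δ g) s
Δ-⋆ f g s = begin
  (f ⋆ g) (suc s) - (f ⋆ g) s
    ≡⟨ cong (_- (f ⋆ g) s) (⋆-suc f g s) ⟩
  (shifted + f (suc s) * g 0) - (f ⋆ g) s
    ≡⟨ rearrange shifted (f (suc s) * g 0) ((f ⋆ g) s) ⟩
  f (suc s) * g 0 + (shifted - (f ⋆ g) s)
    ≡⟨ cong (_+_ (f (suc s) * g 0)) (∑<-minus (suc s) (λ a → f a * g (suc (s ∸ a))) (λ a → f a * g (s ∸ a))) ⟩
  f (suc s) * g 0 + ∑< (suc s) (λ a → f a * g (suc (s ∸ a)) - f a * g (s ∸ a))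
    ≡⟨ cong (_+_ (f (suc s) * g 0)) (∑<-cong (suc s) (λ a _ → sym (*-distribˡ-minus (f a) (g (suc (s ∸ a))) (g (s ∸ a))))) ⟩
  f (suc s) * g 0 + (f ⋆ Δ g) s ∎
  where
    open ≡-Reasoning
    shifted = ∑< (suc s) (λ a → f a * g (suc (s ∸ a)))
    rearrange : ∀ a b c → (a + b) - c ≡ b + (a - c)
    rearrange = solve-∀

Poly<-⋆ : ∀ d e {f g} → Poly< d f → Poly< e g → Poly< (d ℕ.+ e) (f ⋆ g)
Poly<-⋆ d zero {f} {g} pf pg = Poly<-mono {e = d ℕ.+ 0} z≤n vanishes
  where vanishes : Poly< 0 (f ⋆ g)
        vanishes s = ∑<-zero (suc s) _ (λ a _ → trans (cong (f a *_) (pg (s ∸ a))) (ℤP.*-zeroʳ (f a)))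
Poly<-⋆ d (suc e) {f} {g} pf pg = subst (λ k → Poly< k (f ⋆ g)) (sym (ℕP.+-suc d e))
  (Poly<-cong (d ℕ.+ e) (λ s → sym (Δ-⋆ f g s))
    (Poly<-+ (d ℕ.+ e) {λ s → f (suc s) * g 0} {f ⋆ Δ g} head (Poly<-⋆ d e pf pg)))
  where head : Poly< (d ℕ.+ e) (λ s → f (suc s) * g 0)
        head = Poly<-cong (d ℕ.+ e) (λ s → ℤP.*-comm (g 0) (f (suc s)))
                 (Poly<-* (d ℕ.+ e) (g 0) (Poly<-mono (ℕP.m≤m+n d e) (Poly<-shift d pf)))

δ : ℕ → ℤ
δ zero = + 1
δ (suc _) = + 0

-- f is a polynomial of degree < d away from 0; at 0 it falls short of that polynomial by v
AlmostPoly< : ℕ → ℤ → (ℕ → ℤ) → Set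
AlmostPoly< d v f = Poly< d (λ s → f s + v * δ s)

⋆-linearˡ : ∀ f c h g s → ((λ a → f a + c * h a) ⋆ g) s ≡ (f ⋆ g) s + c * (h ⋆ g) s
⋆-linearˡ f c h g s =
  trans (∑<-cong (suc s) (λ a _ → distrib (f a) c (h a) (g (s ∸ a))))
  (trans (∑<-+ (suc s) (λ a → f a * g (s ∸ a)) (λ a → c * (h a * g (s ∸ a))))
         (cong (_+_ ((f ⋆ g) s)) (∑<-* (suc s) c (λ a → h a * g (s ∸ a)))))
  where distrib : ∀ x c y z → (x + c * y) * z ≡ x * z + c * (y * z)
        distrib = solve-∀

⋆-linearʳ : ∀ f g c h s → (f ⋆ (λ a → g a + c * h a)) s ≡ (f ⋆ g) s + c * (f ⋆ h) s
⋆-linearʳ f g c h s =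
  trans (∑<-cong (suc s) (λ a _ → distrib (f a) (g (s ∸ a)) c (h (s ∸ a))))
  (trans (∑<-+ (suc s) (λ a → f a * g (s ∸ a)) (λ a → c * (f a * h (s ∸ a))))
         (cong (_+_ ((f ⋆ g) s)) (∑<-* (suc s) c (λ a → f a * h (s ∸ a)))))
  where distrib : ∀ x y c z → x * (y + c * z) ≡ x * y + c * (x * z)
        distrib = solve-∀

⋆-identityˡ : ∀ g s → (δ ⋆ g) s ≡ g s
⋆-identityˡ g s = trans (cong₂ _+_ (ℤP.*-identityˡ (g s)) (∑<-zero s _ (λ _ _ → refl))) (ℤP.+-identityʳ (g s))

⋆-identityʳ : ∀ f s → (f ⋆ δ) s ≡ f s
⋆-identityʳ f s = begin
  (f ⋆ δ) s
    ≡⟨ ∑<-snoc s (λ a → f a * δ (s ∸ a)) ⟩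
  ∑< s (λ a → f a * δ (s ∸ a)) + f s * δ (s ∸ s)
    ≡⟨ cong₂ _+_ (∑<-zero s _ vanish) (cong (λ t → f s * δ t) (ℕP.n∸n≡0 s)) ⟩
  + 0 + f s * + 1
    ≡⟨ trans (ℤP.+-identityˡ _) (ℤP.*-identityʳ (f s)) ⟩
  f s ∎
  where
    open ≡-Reasoning
    vanish : ∀ a → a ℕ.< s → f a * δ (s ∸ a) ≡ + 0
    vanish a a<s with s ∸ a | ℕP.m<n⇒0<n∸m a<s
    ... | suc _ | _ = ℤP.*-zeroʳ (f a)

-- (f + v δ) ⋆ (g + w δ) - v (g + w δ) - w (f + v δ) = f ⋆ g - v w δ
AlmostPoly<-⋆ : ∀ d e v w f g → AlmostPoly< d v f → AlmostPoly< e w g → AlmostPoly< (d ℕ.+ e) (- (v * w)) (f ⋆ g)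
AlmostPoly<-⋆ d e v w f g pf pg =
  Poly<-cong (d ℕ.+ e) expand
    (Poly<-+ (d ℕ.+ e) (Poly<-+ (d ℕ.+ e) (Poly<-⋆ d e pf pg)
                          (Poly<-* (d ℕ.+ e) (- v) (Poly<-mono (ℕP.m≤n+m e d) pg)))
                       (Poly<-* (d ℕ.+ e) (- w) (Poly<-mono (ℕP.m≤m+n d e) pf)))
  where
    f̃ = λ s → f s + v * δ s
    g̃ = λ s → g s + w * δ s
    expand : ∀ s → (f̃ ⋆ g̃) s + (- v) * g̃ s + (- w) * f̃ s ≡ (f ⋆ g) s + (- (v * w)) * δ s
    expand s = trans (cong (λ t → t + (- v) * g̃ s + (- w) * f̃ s)
                       (trans (⋆-linearˡ f v δ g̃ s)
                         (cong₂ _+_ (trans (⋆-linearʳ f g w δ s) (cong (λ t → (f ⋆ g) s + w * t) (⋆-identityʳ f s)))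
                                    (cong (v *_) (⋆-identityˡ g̃ s)))))
                     (cancel ((f ⋆ g) s) (f s) (g s) (δ s) v w)
      where cancel : ∀ C F G D v w → C + w * F + v * (G + w * D) + (- v) * (G + w * D) + (- w) * (F + v * D)
                                     ≡ C + (- (v * w)) * D
            cancel = solve-∀

positivePow : ℕ → ℕ → ℤ
positivePow k zero = + 0
positivePow k (suc a) = + (suc a ^ k)

AlmostPoly<-positivePow : ∀ k → AlmostPoly< (suc k) (+ (0 ^ k)) (positivePow k)
AlmostPoly<-positivePow k = Poly<-cong (suc k) split (Poly<-pow k)
  where split : ∀ s → + (s ^ k) ≡ positivePow k s + + (0 ^ k) * δ s
        split zero = trans (sym (ℤP.*-identityʳ (+ (0 ^ k)))) (sym (ℤP.+-identityˡ _))
        split (suc s) = trans (sym (ℤP.+-identityʳ _)) (cong (_+_ (+ (suc s ^ k))) (sym (ℤP.*-zeroʳ (+ (0 ^ k)))))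

compositionConv : ∀ {r} → (Fin r → ℕ) → ℕ → ℤ
compositionConv {zero} b = δ
compositionConv {suc r} b = positivePow (b fz ∸ 1) ⋆ compositionConv (b ∘ fs)

total : ∀ {r} → (Fin r → ℕ) → ℕ
total {zero} b = 0
total {suc r} b = b fz ℕ.+ total (b ∘ fs)

defect : ∀ {r} → (Fin r → ℕ) → ℤ
defect {zero} b = - (+ 1)
defect {suc r} b = - (+ (0 ^ (b fz ∸ 1)) * defect (b ∘ fs))

suc[m∸1]≡m : ∀ {m} → 1 ℕ.≤ m → suc (m ∸ 1) ≡ m
suc[m∸1]≡m {suc m} _ = refl

AlmostPoly<-compositionConv : ∀ {r} (b : Fin r → ℕ) → (∀ i → 1 ℕ.≤ b i) →
                              AlmostPoly< (total b) (defect b) (compositionConv b)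
AlmostPoly<-compositionConv {zero} b b≥1 s = cancel (δ s)
  where cancel : ∀ x → x + (- (+ 1)) * x ≡ + 0
        cancel = solve-∀
AlmostPoly<-compositionConv {suc r} b b≥1 =
  subst (λ k → AlmostPoly< (k ℕ.+ total (b ∘ fs)) (defect b) (compositionConv b)) (suc[m∸1]≡m (b≥1 fz))
    (AlmostPoly<-⋆ (suc (b fz ∸ 1)) (total (b ∘ fs)) (+ (0 ^ (b fz ∸ 1))) (defect (b ∘ fs))
                   (positivePow (b fz ∸ 1)) (compositionConv (b ∘ fs))
      (AlmostPoly<-positivePow (b fz ∸ 1)) (AlmostPoly<-compositionConv (b ∘ fs) (b≥1 ∘ fs)))

defect≡0 : ∀ {r} (b : Fin r → ℕ) → (∃ λ i → 2 ℕ.≤ b i) → defect b ≡ + 0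
defect≡0 {suc r} b (fz , b₀≥2) = cong (λ z → - (+ z * defect (b ∘ fs))) (0^[m∸1]≡0 b₀≥2)
  where 0^[m∸1]≡0 : ∀ {m} → 2 ℕ.≤ m → 0 ^ (m ∸ 1) ≡ 0
        0^[m∸1]≡0 (s≤s (s≤s _)) = refl
defect≡0 {suc r} b (fs i , bᵢ≥2) =
  trans (cong (λ t → - (+ (0 ^ (b fz ∸ 1)) * t)) (defect≡0 (b ∘ fs) (i , bᵢ≥2)))
        (cong -_ (ℤP.*-zeroʳ (+ (0 ^ (b fz ∸ 1)))))

Poly<-compositionConv : ∀ {r} (b : Fin r → ℕ) → (∀ i → 1 ℕ.≤ b i) → (∃ λ i → 2 ℕ.≤ b i) →
                        Poly< (total b) (compositionConv b)
Poly<-compositionConv b b≥1 big =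
  Poly<-cong (total b) (λ s → trans (cong (λ t → compositionConv b s + t * δ s) (defect≡0 b big)) (ℤP.+-identityʳ _))
    (AlmostPoly<-compositionConv b b≥1)

compositionConv-below : ∀ {r} (b : Fin r → ℕ) s → s ℕ.< r → compositionConv b s ≡ + 0
compositionConv-below {suc r} b s s<r = ∑<-zero (suc s) _ vanish
  where vanish : ∀ a → a ℕ.< suc s → positivePow (b fz ∸ 1) a * compositionConv (b ∘ fs) (s ∸ a) ≡ + 0
        vanish zero _ = refl
        vanish (suc a) (s≤s a<s) =
          trans (cong (positivePow (b fz ∸ 1) (suc a) *_)
                      (compositionConv-below (b ∘ fs) (s ∸ suc a) (ℕP.<-≤-trans (ℕP.∸-monoʳ-< (s≤s z≤n) a<s) (ℕP.≤-pred s<r))))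
                (ℤP.*-zeroʳ (positivePow (b fz ∸ 1) (suc a)))

altBinomial : ℕ → (ℕ → ℤ) → ℤ
altBinomial n f = ∑< (suc n) (λ s → sgn s * + (n C s) * f s)

nC0≡1 : ∀ n → n C 0 ≡ 1
nC0≡1 n = trans (nCk≡nC[n∸k] {0} {n} z≤n) (nCn≡1 n)

-- Pascal's rule splits each binomial coefficient of row n + 1 into two of row n.
altBinomial-suc : ∀ n f → altBinomial (suc n) f ≡ altBinomial n f - altBinomial n (f ∘ suc)
altBinomial-suc n f = begin
  altBinomial (suc n) f
    ≡⟨ cong₂ _+_ (cong (λ c → + 1 * + c * f 0) (nC0≡1 (suc n))) (∑<-cong (suc n) (λ s _ → pascal s)) ⟩
  f₀ + ∑< (suc n) (λ s → - (A s + B s))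
    ≡⟨ cong (_+_ f₀) (trans (∑<-neg (suc n) (λ s → A s + B s)) (cong -_ (∑<-+ (suc n) A B))) ⟩
  f₀ + - (altBinomial n (f ∘ suc) + ∑< (suc n) B)
    ≡⟨ cong (λ t → f₀ + - (altBinomial n (f ∘ suc) + t)) B-sum ⟩
  f₀ + - (altBinomial n (f ∘ suc) + - ∑< n T)
    ≡⟨ rearrange f₀ (altBinomial n (f ∘ suc)) (∑< n T) ⟩
  (f₀ + ∑< n T) - altBinomial n (f ∘ suc)
    ≡⟨ cong (λ c → (+ 1 * + c * f 0 + ∑< n T) - altBinomial n (f ∘ suc)) (sym (nC0≡1 n)) ⟩
  altBinomial n f - altBinomial n (f ∘ suc) ∎
  where
    open ≡-Reasoning
    f₀ : ℤ
    f₀ = + 1 * + 1 * f 0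
    A B T : ℕ → ℤ
    A s = sgn s * + (n C s) * f (suc s)
    B s = sgn s * + (n C suc s) * f (suc s)
    T s = sgn (suc s) * + (n C suc s) * f (suc s)
    rearrange : ∀ x a b → x + - (a + - b) ≡ (x + b) - a
    rearrange = solve-∀
    pascal : ∀ s → sgn (suc s) * + (suc n C suc s) * f (suc s) ≡ - (A s + B s)
    pascal s = trans (cong (λ c → - sgn s * + c * f (suc s)) (sym (nCk+nC[k+1]≡[n+1]C[k+1] n s)))
                     (trans (cong (λ c → - sgn s * c * f (suc s)) (ℤP.pos-+ (n C s) (n C suc s)))
                            (distrib (sgn s) (+ (n C s)) (+ (n C suc s)) (f (suc s))))
      where distrib : ∀ σ a b x → - σ * (a + b) * x ≡ - (σ * a * x + σ * b * x)
            distrib = solve-∀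
    B-sum : ∑< (suc n) B ≡ - ∑< n T
    B-sum = trans (∑<-snoc n B)
      (trans (cong (_+_ (∑< n B)) last-vanishes)
      (trans (ℤP.+-identityʳ _) (trans (∑<-cong n (λ s _ → flip (sgn s) _ _)) (∑<-neg n _))))
      where
        last-vanishes : B n ≡ + 0
        last-vanishes = trans (cong (λ c → sgn n * + c * f (suc n)) (k>n⇒nCk≡0 (ℕP.n<1+n n)))
                              (trans (cong (_* f (suc n)) (ℤP.*-zeroʳ (sgn n))) (ℤP.*-zeroˡ (f (suc n))))
        flip : ∀ σ c x → σ * c * x ≡ - (- σ * c * x)
        flip = solve-∀

altBinomial-Δ : ∀ n f → altBinomial n (Δ f) ≡ altBinomial n (f ∘ suc) - altBinomial n f
altBinomial-Δ n f = trans (∑<-cong (suc n) (λ s _ → *-distribˡ-minus (sgn s * + (n C s)) (f (suc s)) (f s)))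
                          (sym (∑<-minus (suc n) (λ s → sgn s * + (n C s) * f (suc s)) (λ s → sgn s * + (n C s) * f s)))

altBinomial-Poly< : ∀ n f → Poly< n f → altBinomial n f ≡ + 0
altBinomial-Poly< zero f pf = trans (ℤP.+-identityʳ _) (trans (ℤP.*-identityˡ (f 0)) (pf 0))
altBinomial-Poly< (suc n) f pf = begin
  altBinomial (suc n) f                          ≡⟨ altBinomial-suc n f ⟩
  altBinomial n f - altBinomial n (f ∘ suc)      ≡⟨ swap-minus (altBinomial n f) _ ⟩
  - (altBinomial n (f ∘ suc) - altBinomial n f)  ≡⟨ cong -_ (sym (altBinomial-Δ n f)) ⟩
  - altBinomial n (Δ f)                          ≡⟨ cong -_ (altBinomial-Poly< n (Δ f) pf) ⟩
  + 0                                            ∎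
  where
    open ≡-Reasoning
    swap-minus : ∀ a b → a - b ≡ - (b - a)
    swap-minus = solve-∀

monomial : ∀ {r} → (Fin r → ℕ) → Vec ℕ r → ℤ
monomial {r} b a = + product (map (λ k → lookup a k ^ (b k ∸ 1)) (allFin r))

map-allFin-suc : ∀ {A : Set} {r} (g : Fin (suc r) → A) → map g (allFin (suc r)) ≡ g fz ∷ map (g ∘ fs) (allFin r)
map-allFin-suc g = cong (g fz ∷_) (trans (LP.map-tabulate fs g) (sym (LP.map-tabulate (λ k → k) (g ∘ fs))))

monomial-∷ : ∀ {r} (b : Fin (suc r) → ℕ) x a → monomial b (x ∷ a) ≡ + (x ^ (b fz ∸ 1)) * monomial (b ∘ fs) a
monomial-∷ b x a = trans (cong (+_ ∘ product) (map-allFin-suc (λ k → lookup (x ∷ a) k ^ (b k ∸ 1))))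
                         (ℤP.pos-* (x ^ (b fz ∸ 1)) _)

compSumOver : ∀ {r} → List ℕ → ℕ → (Fin r → ℕ) → ℤ
compSumOver {r} xs t b = ∑ (vecsFrom xs r) (λ a → when (does (Vec.sum a ℕP.≟ t)) (monomial b a))

m+n≡o⇔n≡o∸m : ∀ {x t} m → x ℕ.≤ t → (x ℕ.+ m ≡ t) ⇔ (m ≡ t ∸ x)
m+n≡o⇔n≡o∸m {x} m x≤t = mk⇔ (λ e → trans (sym (ℕP.m+n∸m≡n x m)) (cong (_∸ x) e))
                          (λ e → trans (cong (x ℕ.+_) e) (ℕP.m+[n∸m]≡n x≤t))

compSumOver-head : ∀ {r} xs t (b : Fin (suc r) → ℕ) x →
                   ∑ (vecsFrom xs r) (λ a → when (does (x ℕ.+ Vec.sum a ℕP.≟ t)) (monomial b (x ∷ a)))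
                   ≡ when (does (x ℕ.≤? t)) (+ (x ^ (b fz ∸ 1)) * compSumOver xs (t ∸ x) (b ∘ fs))
compSumOver-head {r} xs t b x with x ℕ.≤? t
... | yes x≤t = begin
  ∑ (vecsFrom xs r) (λ a → when (does (x ℕ.+ Vec.sum a ℕP.≟ t)) (monomial b (x ∷ a)))
    ≡⟨ ∑-cong (vecsFrom xs r) term ⟩
  ∑ (vecsFrom xs r) (λ a → xᵏ * tail a)
    ≡⟨ ∑-* (vecsFrom xs r) xᵏ tail ⟩
  xᵏ * compSumOver xs (t ∸ x) (b ∘ fs)
    ≡⟨ sym (when-yes (x ℕ.≤? t) x≤t) ⟩
  when (does (x ℕ.≤? t)) (xᵏ * compSumOver xs (t ∸ x) (b ∘ fs)) ∎
  where
    open ≡-Reasoning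
    xᵏ : ℤ
    xᵏ = + (x ^ (b fz ∸ 1))
    tail : Vec ℕ r → ℤ
    tail a = when (does (Vec.sum a ℕP.≟ t ∸ x)) (monomial (b ∘ fs) a)
    term : ∀ a → when (does (x ℕ.+ Vec.sum a ℕP.≟ t)) (monomial b (x ∷ a)) ≡ xᵏ * tail a
    term a = trans (cong₂ when (does-⇔ (m+n≡o⇔n≡o∸m (Vec.sum a) x≤t) (x ℕ.+ Vec.sum a ℕP.≟ t) (Vec.sum a ℕP.≟ t ∸ x))
                               (monomial-∷ b x a))
                   (when-* (does (Vec.sum a ℕP.≟ t ∸ x)) xᵏ (monomial (b ∘ fs) a))
... | no x≰t = trans (∑-zero (vecsFrom xs r) _ (λ a → when-no (x ℕ.+ Vec.sum a ℕP.≟ t) (x≰t ∘ x≤ a)))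
                     (sym (when-no (x ℕ.≤? t) x≰t))
  where x≤ : ∀ a → x ℕ.+ Vec.sum a ≡ t → x ℕ.≤ t
        x≤ a e = subst (x ℕ.≤_) e (ℕP.m≤m+n x _)

compSumOver-suc : ∀ {r} xs t (b : Fin (suc r) → ℕ) →
                  compSumOver xs t b ≡ ∑ xs (λ x → when (does (x ℕ.≤? t)) (+ (x ^ (b fz ∸ 1)) * compSumOver xs (t ∸ x) (b ∘ fs)))
compSumOver-suc {r} xs t b =
  trans (∑-concatMap (λ x → map (x ∷_) (vecsFrom xs r)) xs _)
        (∑-cong xs (λ x → trans (∑-map (x ∷_) (vecsFrom xs r) _) (compSumOver-head xs t b x)))

-- the summands of compSum s are bounded by s, so the enumeration from [1..m] is exhaustive for every m ≥ s
compSumOver≡compositionConv : ∀ {r} (b : Fin r → ℕ) m t → t ℕ.≤ m → compSumOver (oneTo m) t b ≡ compositionConv b t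
compSumOver≡compositionConv {zero} b m zero _ = refl
compSumOver≡compositionConv {zero} b m (suc t) _ = refl
compSumOver≡compositionConv {suc r} b m t t≤m = begin
  compSumOver (oneTo m) t b
    ≡⟨ compSumOver-suc (oneTo m) t b ⟩
  ∑ (oneTo m) (λ x → when (does (x ℕ.≤? t)) (+ (x ^ (b fz ∸ 1)) * compSumOver (oneTo m) (t ∸ x) (b ∘ fs)))
    ≡⟨ ∑-cong (oneTo m) (λ x → when-cong (x ℕ.≤? t) (λ _ → cong (+ (x ^ (b fz ∸ 1)) *_)
         (compSumOver≡compositionConv (b ∘ fs) m (t ∸ x) (ℕP.≤-trans (ℕP.m∸n≤m t x) t≤m)))) ⟩
  ∑ (map suc (upTo m)) (λ x → when (does (x ℕ.≤? t)) (+ (x ^ (b fz ∸ 1)) * compositionConv (b ∘ fs) (t ∸ x)))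
    ≡⟨ trans (∑-map suc (upTo m) _) (∑-applyUpTo (λ i → i) m _) ⟩
  ∑< m (λ i → when (does (suc i ℕ.≤? t)) (positivePow (b fz ∸ 1) (suc i) * compositionConv (b ∘ fs) (t ∸ suc i)))
    ≡⟨ ∑<-truncate m t _ t≤m ⟩
  ∑< t (λ i → positivePow (b fz ∸ 1) (suc i) * compositionConv (b ∘ fs) (t ∸ suc i))
    ≡⟨ sym (ℤP.+-identityˡ _) ⟩
  compositionConv b t ∎
  where open ≡-Reasoning

compSum≡compositionConv : ∀ {r} (b : Fin r → ℕ) s → compSum s b ≡ compositionConv b s
compSum≡compositionConv {r} b s =
  trans (sumWhere≡∑-when (λ a → Vec.sum a ℕP.≟ s) (monomial b) (vecsFrom (oneTo s) r))
        (compSumOver≡compositionConv b s s ℕP.≤-refl)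

sum≡total : ∀ {r} (b : Fin r → ℕ) → sum (map b (allFin r)) ≡ total b
sum≡total {zero} b = refl
sum≡total {suc r} b = trans (cong sum (map-allFin-suc b)) (cong (b fz ℕ.+_) (sum≡total (b ∘ fs)))

sumℤ-range : ∀ r m (f : ℕ → ℤ) → sumℤ (map f (map (r ℕ.+_) (upTo m))) ≡ ∑< m (λ i → f (r ℕ.+ i))
sumℤ-range r m f = trans (sumℤ-map (map (r ℕ.+_) (upTo m)) f)
                         (trans (∑-map (r ℕ.+_) (upTo m) f) (∑-applyUpTo (λ i → i) m (f ∘ (r ℕ.+_))))

LHS≡0 : ∀ n {r} (b : Fin r → ℕ) → (∀ i → 1 ℕ.≤ b i) → (∃ λ i → 2 ℕ.≤ b i) →
        sum (map b (allFin r)) ≡ n → r ℕ.≤ n → LHS n b ≡ + 0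
LHS≡0 n {r} b b≥1 big b-sum r≤n = begin
  LHS n b
    ≡⟨ sumℤ-range r (suc (n ∸ r)) term ⟩
  ∑< (suc (n ∸ r)) (term ∘ (r ℕ.+_))
    ≡⟨ ∑<-cong (suc (n ∸ r)) (λ i _ → cong (sgn (r ℕ.+ i) * + (n C (r ℕ.+ i)) *_) (compSum≡compositionConv b (r ℕ.+ i))) ⟩
  ∑< (suc (n ∸ r)) (term′ ∘ (r ℕ.+_))
    ≡⟨ sym (trans (cong (_+ ∑< (suc (n ∸ r)) (term′ ∘ (r ℕ.+_))) (∑<-zero r term′ below-r)) (ℤP.+-identityˡ _)) ⟩
  ∑< r term′ + ∑< (suc (n ∸ r)) (term′ ∘ (r ℕ.+_))
    ≡⟨ sym (∑<-split r (suc (n ∸ r)) term′) ⟩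
  ∑< (r ℕ.+ suc (n ∸ r)) term′
    ≡⟨ cong (λ k → ∑< k term′) (trans (ℕP.+-suc r (n ∸ r)) (cong suc (ℕP.m+[n∸m]≡n r≤n))) ⟩
  altBinomial n (compositionConv b)
    ≡⟨ altBinomial-Poly< n (compositionConv b) poly ⟩
  + 0 ∎
  where
    open ≡-Reasoning
    term term′ : ℕ → ℤ
    term s = sgn s * + (n C s) * compSum s b
    term′ s = sgn s * + (n C s) * compositionConv b s
    below-r : ∀ s → s ℕ.< r → term′ s ≡ + 0
    below-r s s<r = trans (cong (sgn s * + (n C s) *_) (compositionConv-below b s s<r)) (ℤP.*-zeroʳ (sgn s * + (n C s)))
    poly : Poly< n (compositionConv b)
    poly = subst (λ k → Poly< k (compositionConv b)) (trans (sym (sum≡total b)) b-sum) (Poly<-compositionConv b b≥1 big)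

x≡-x⇒x≡0 : ∀ {x : ℤ} → x ≡ - x → x ≡ + 0
x≡-x⇒x≡0 {+ zero} _ = refl
x≡-x⇒x≡0 {+ suc n} ()
x≡-x⇒x≡0 {ℤ.-[1+ n ]} ()

module _ {X : Set} (_≟_ : DecidableEquality X) where

  multiplicity : X → List X → ℤ
  multiplicity z xs = ∑ xs (λ y → when (does (y ≟ z)) (+ 1))

  ∑-select : ∀ xs z (g : X → ℤ) → multiplicity z xs ≡ + 1 → ∑ xs (λ y → when (does (y ≟ z)) (g y)) ≡ g z
  ∑-select xs z g once = begin
    ∑ xs (λ y → when (does (y ≟ z)) (g y))       ≡⟨ ∑-cong xs at-z ⟩
    ∑ xs (λ y → g z * when (does (y ≟ z)) (+ 1)) ≡⟨ ∑-* xs (g z) _ ⟩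
    g z * multiplicity z xs                      ≡⟨ trans (cong (g z *_) once) (ℤP.*-identityʳ (g z)) ⟩
    g z                                          ∎
    where
      open ≡-Reasoning
      at-z : ∀ y → when (does (y ≟ z)) (g y) ≡ g z * when (does (y ≟ z)) (+ 1)
      at-z y with y ≟ z
      ... | yes refl = sym (ℤP.*-identityʳ (g y))
      ... | no _ = sym (ℤP.*-zeroʳ (g z))

  ∑-involution : ∀ xs → (∀ z → multiplicity z xs ≡ + 1) → (ι : X → X) → (∀ x → ι (ι x) ≡ x) →
                 (g : X → ℤ) → ∑ xs (g ∘ ι) ≡ ∑ xs g
  ∑-involution xs once ι ι-ι g = begin
    ∑ xs (g ∘ ι)
      ≡⟨ ∑-cong xs (λ x → sym (∑-select xs (ι x) g (once (ι x)))) ⟩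
    ∑ xs (λ x → ∑ xs (λ y → when (does (y ≟ ι x)) (g y)))
      ≡⟨ ∑-swap xs xs (λ x y → when (does (y ≟ ι x)) (g y)) ⟩
    ∑ xs (λ y → ∑ xs (λ x → when (does (y ≟ ι x)) (g y)))
      ≡⟨ ∑-cong xs (λ y → ∑-cong xs (λ x → cong (λ c → when c (g y)) (does-⇔ (transpose x y) (y ≟ ι x) (x ≟ ι y)))) ⟩
    ∑ xs (λ y → ∑ xs (λ x → when (does (x ≟ ι y)) (g y)))
      ≡⟨ ∑-cong xs (λ y → ∑-select xs (ι y) (λ _ → g y) (once (ι y))) ⟩
    ∑ xs g ∎
    where
      open ≡-Reasoning
      transpose : ∀ x y → (y ≡ ι x) ⇔ (x ≡ ι y)
      transpose x y = mk⇔ (λ e → trans (sym (ι-ι x)) (cong ι (sym e))) (λ e → trans (sym (ι-ι y)) (cong ι (sym e)))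

  -- ι need only be given on P; outside P it is extended by the identity.
  module _ {P : X → Set} (P? : (x : X) → Dec (P x)) (w : X → ℤ) (ι : X → X)
           (ι-P : ∀ x → P x → P (ι x)) (ι-ι : ∀ x → P x → ι (ι x) ≡ x) (w-ι : ∀ x → P x → w (ι x) ≡ - w x) where

    private
      extend : (x : X) → Dec (P x) → X
      extend x (yes _) = ι x
      extend x (no _) = x

      ι̂ : X → X
      ι̂ x = extend x (P? x)

      g : X → ℤ
      g x = when (does (P? x)) (w x)

      ι̂-ι̂ : ∀ x → ι̂ (ι̂ x) ≡ x
      ι̂-ι̂ x with P? x
      ... | no ¬p rewrite dec-no (P? x) ¬p = refl
      ... | yes p with P? (ι x)
      ...   | yes _ = ι-ι x p
      ...   | no ¬p = ⊥-elim (¬p (ι-P x p))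

      g-ι̂ : ∀ x → g (ι̂ x) ≡ - g x
      g-ι̂ x with P? x
      ... | no ¬p rewrite dec-no (P? x) ¬p = refl
      ... | yes p with P? (ι x)
      ...   | yes _ = w-ι x p
      ...   | no ¬p = ⊥-elim (¬p (ι-P x p))

    sumWhere-involution≡0 : ∀ xs → (∀ z → multiplicity z xs ≡ + 1) → sumWhere P? w xs ≡ + 0
    sumWhere-involution≡0 xs once = trans (sumWhere≡∑-when P? w xs) (x≡-x⇒x≡0 (begin
      ∑ xs g             ≡⟨ sym (∑-involution xs once ι̂ ι̂-ι̂ g) ⟩
      ∑ xs (g ∘ ι̂)       ≡⟨ ∑-cong xs g-ι̂ ⟩
      ∑ xs (λ x → - g x) ≡⟨ ∑-neg xs g ⟩
      - ∑ xs g           ∎))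
      where open ≡-Reasoning

_≟×_ : {A B : Set} → DecidableEquality A → DecidableEquality B → DecidableEquality (A × B)
(_≟A_ ≟× _≟B_) (x , u) (y , v) = map′ ×-≡,≡→≡ ×-≡,≡←≡ (x ≟A y ×-dec u ≟B v)

multiplicity-vecsFrom : {A : Set} (_≟_ : DecidableEquality A) (xs : List A) → (∀ z → multiplicity _≟_ z xs ≡ + 1) →
                        ∀ r (v : Vec A r) → multiplicity (VP.≡-dec _≟_) v (vecsFrom xs r) ≡ + 1
multiplicity-vecsFrom _≟_ xs once zero [] = refl
multiplicity-vecsFrom _≟_ xs once (suc r) (z ∷ zs) = begin
  multiplicity (VP.≡-dec _≟_) (z ∷ zs) (vecsFrom xs (suc r))
    ≡⟨ ∑-concatMap (λ x → map (x ∷_) (vecsFrom xs r)) xs _ ⟩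
  ∑ xs (λ x → ∑ (map (x ∷_) (vecsFrom xs r)) (λ v → when (does (VP.≡-dec _≟_ v (z ∷ zs))) (+ 1)))
    ≡⟨ ∑-cong xs (λ x → trans (∑-map (x ∷_) (vecsFrom xs r) _) (trans
         (∑-cong (vecsFrom xs r) (λ v → when-∧ (does (x ≟ z)) (does (VP.≡-dec _≟_ v zs)) (+ 1)))
         (∑-when (vecsFrom xs r) (does (x ≟ z)) _))) ⟩
  ∑ xs (λ x → when (does (x ≟ z)) (multiplicity (VP.≡-dec _≟_) zs (vecsFrom xs r)))
    ≡⟨ ∑-cong xs (λ x → cong (when (does (x ≟ z))) (multiplicity-vecsFrom _≟_ xs once r zs)) ⟩
  multiplicity _≟_ z xs
    ≡⟨ once z ⟩
  + 1 ∎
  where open ≡-Reasoning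

multiplicity-product : {A B : Set} (_≟A_ : DecidableEquality A) (_≟B_ : DecidableEquality B) (xs : List A) (ys : List B) →
                       (∀ x → multiplicity _≟A_ x xs ≡ + 1) → (∀ y → multiplicity _≟B_ y ys ≡ + 1) →
                       ∀ x y → multiplicity (_≟A_ ≟× _≟B_) (x , y) (concatMap (λ a → map (a ,_) ys) xs) ≡ + 1
multiplicity-product _≟A_ _≟B_ xs ys onceA onceB x y =
  trans (∑-concatMap (λ a → map (a ,_) ys) xs _)
  (trans (∑-cong xs (λ a → trans (∑-map (a ,_) ys _)
           (trans (∑-cong ys (λ b → when-∧ (does (a ≟A x)) (does (b ≟B y)) (+ 1)))
           (trans (∑-when ys (does (a ≟A x)) _)
                  (cong (when (does (a ≟A x))) (onceB y))))))
         (onceA x))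

multiplicity-allFin : ∀ n (z : Fin n) → multiplicity FP._≟_ z (allFin n) ≡ + 1
multiplicity-allFin (suc n) z =
  trans (cong (λ ys → when (does (fz FP.≟ z)) (+ 1) + ∑ ys (λ y → when (does (y FP.≟ z)) (+ 1)))
              (sym (LP.map-tabulate (λ k → k) fs)))
        (trans (cong (_+_ (when (does (fz FP.≟ z)) (+ 1))) (∑-map fs (allFin n) _)) (split z))
  where
    split : ∀ z → when (does (fz FP.≟ z)) (+ 1) + ∑ (allFin n) (λ y → when (does (fs y FP.≟ z)) (+ 1)) ≡ + 1
    split fz = cong (_+_ (+ 1)) (∑-zero (allFin n) _ (λ _ → refl))
    split (fs z) = trans (ℤP.+-identityˡ _) (multiplicity-allFin n z)

_≟-pair_ : ∀ {n} → DecidableEquality (Subset n × Vec (Fin n) n)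
_≟-pair_ = VP.≡-dec BP._≟_ ≟× VP.≡-dec FP._≟_

multiplicity-pairs : ∀ n x → multiplicity _≟-pair_ x (pairs n) ≡ + 1
multiplicity-pairs n (S , θ) =
  multiplicity-product (VP.≡-dec BP._≟_) (VP.≡-dec FP._≟_) (vecsFrom (true ∷ false ∷ []) n) (vecsFrom (allFin n) n)
    (multiplicity-vecsFrom BP._≟_ _ bool-once n) (multiplicity-vecsFrom FP._≟_ _ (multiplicity-allFin n) n) S θ
  where
    bool-once : ∀ x → multiplicity BP._≟_ x (true ∷ false ∷ []) ≡ + 1
    bool-once true = refl
    bool-once false = refl

lookup-≗⇒≡ : ∀ {A : Set} {n} (v w : Vec A n) → (∀ k → lookup v k ≡ lookup w k) → v ≡ w
lookup-≗⇒≡ v w e = trans (sym (VP.tabulate∘lookup v)) (trans (VP.tabulate-cong e) (VP.tabulate∘lookup w))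

toggle : ∀ {n} → Subset n → Fin n → Subset n
toggle (x ∷ xs) fz = not x ∷ xs
toggle (x ∷ xs) (fs i) = x ∷ toggle xs i

lookup-toggle-≢ : ∀ {n} (S : Subset n) i j → j ≢ i → lookup (toggle S i) j ≡ lookup S j
lookup-toggle-≢ (x ∷ xs) fz fz j≢i = ⊥-elim (j≢i refl)
lookup-toggle-≢ (x ∷ xs) fz (fs j) j≢i = refl
lookup-toggle-≢ (x ∷ xs) (fs i) fz j≢i = refl
lookup-toggle-≢ (x ∷ xs) (fs i) (fs j) j≢i = lookup-toggle-≢ xs i j (j≢i ∘ cong fs)

∈-toggle : ∀ {n} {S : Subset n} {i j} → j ≢ i → j ∈ S → j ∈ toggle S i
∈-toggle {S = S} {i} {j} j≢i j∈S = VP.lookup⇒[]= j (toggle S i) (trans (lookup-toggle-≢ S i j j≢i) (VP.[]=⇒lookup j∈S))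

∈-toggle⁻ : ∀ {n} {S : Subset n} {i j} → j ≢ i → j ∈ toggle S i → j ∈ S
∈-toggle⁻ {S = S} {i} {j} j≢i j∈ = VP.lookup⇒[]= j S (trans (sym (lookup-toggle-≢ S i j j≢i)) (VP.[]=⇒lookup j∈))

toggle-involutive : ∀ {n} (S : Subset n) i → toggle (toggle S i) i ≡ S
toggle-involutive (x ∷ xs) fz = cong (_∷ xs) (BP.not-involutive x)
toggle-involutive (x ∷ xs) (fs i) = cong (x ∷_) (toggle-involutive xs i)

sgn-∣toggle∣ : ∀ {n} (S : Subset n) i → sgn ∣ toggle S i ∣ ≡ - sgn ∣ S ∣
sgn-∣toggle∣ (true ∷ xs) fz = sym (ℤP.neg-involutive (sgn ∣ xs ∣))
sgn-∣toggle∣ (false ∷ xs) fz = refl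
sgn-∣toggle∣ (true ∷ xs) (fs i) = cong -_ (sgn-∣toggle∣ xs i)
sgn-∣toggle∣ (false ∷ xs) (fs i) = sgn-∣toggle∣ xs i

down : ∀ {n} → Fin n → Subset n
down m = tabulate (λ i → does (i FP.≤? m))

∣down∣ : ∀ {n} (m : Fin n) → ∣ down m ∣ ≡ suc (toℕ m)
∣down∣ {suc n} fz = cong suc (none n)
  where none : ∀ n → ∣ tabulate {n = n} (λ _ → false) ∣ ≡ 0
        none zero = refl
        none (suc n) = none n
∣down∣ {suc n} (fs m) = cong suc (trans (cong (∣_∣ {n}) (VP.tabulate-cong shift)) (∣down∣ m))
  where shift : ∀ i → does (fs i FP.≤? fs m) ≡ does (i FP.≤? m)
        shift i = does-⇔ (mk⇔ ℕP.≤-pred s≤s) (fs i FP.≤? fs m) (i FP.≤? m)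

lookup-down : ∀ {n} (m i : Fin n) → lookup (down m) i ≡ does (i FP.≤? m)
lookup-down m = VP.lookup∘tabulate (λ j → does (j FP.≤? m))

∈down : ∀ {n} {m i : Fin n} → i F.≤ m → i ∈ down m
∈down {m = m} {i} i≤m = VP.lookup⇒[]= i (down m) (trans (lookup-down m i) (dec-true (i FP.≤? m) i≤m))

∈down⁻ : ∀ {n} {m i : Fin n} → i ∈ down m → i F.≤ m
∈down⁻ {m = m} {i} i∈ with i FP.≤? m
... | yes i≤m = i≤m
... | no i≰m with () ← trans (sym (dec-false (i FP.≤? m) i≰m))
                            (trans (sym (lookup-down m i)) (VP.[]=⇒lookup i∈))

sucF : ∀ {n} → Fin n → Fin n
sucF {suc zero} fz = fz
sucF {suc (suc n)} fz = fs fz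
sucF {suc (suc n)} (fs i) = fs (sucF i)

toℕ-sucF : ∀ {n} (i : Fin n) → suc (toℕ i) ℕ.< n → toℕ (sucF i) ≡ suc (toℕ i)
toℕ-sucF {suc zero} fz (s≤s ())
toℕ-sucF {suc (suc n)} fz _ = refl
toℕ-sucF {suc (suc n)} (fs i) (s≤s i+1<n) = cong suc (toℕ-sucF i i+1<n)

toℕ-pred : ∀ {n} (i : Fin n) → toℕ (F.pred i) ≡ toℕ i ∸ 1
toℕ-pred fz = refl
toℕ-pred (fs i) = FP.toℕ-inject₁ i

injective⇒surjective : ∀ {n} (h : Fin n → Fin n) → (∀ {i j} → h i ≡ h j → i ≡ j) → ∀ x → ∃ λ i → h i ≡ x
injective⇒surjective {suc n} h inj x with FP.any? (λ i → h i FP.≟ x)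
... | yes hit = hit
... | no miss = ⊥-elim (collision (FP.pigeonhole (ℕP.n<1+n n) (λ i → punchOut (x≢h i))))
  where
    x≢h : ∀ i → x ≢ h i
    x≢h i e = miss (i , sym e)
    collision : (∃₂ λ i j → i F.< j × punchOut (x≢h i) ≡ punchOut (x≢h j)) → ⊥
    collision (i , j , i<j , same) = FP.<-irrefl (inj (FP.punchOut-injective (x≢h i) (x≢h j) same)) i<j

surjective⇒injective : ∀ {n} (θ : Fin n → Fin n) → (∀ y → ∃ λ k → θ k ≡ y) → ∀ {j k} → θ j ≡ θ k → j ≡ k
surjective⇒injective θ onto {j} {k} θj≡θk = trans (h∘θ j) (trans (cong h θj≡θk) (sym (h∘θ k)))
  where
    h : _ → _
    h y = proj₁ (onto y)
    θ∘h : ∀ y → θ (h y) ≡ y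
    θ∘h y = proj₂ (onto y)
    h-onto : ∀ x → ∃ λ y → h y ≡ x
    h-onto = injective⇒surjective h (λ {y} {y′} e → trans (sym (θ∘h y)) (trans (cong θ e) (θ∘h y′)))
    h∘θ : ∀ x → x ≡ h (θ x)
    h∘θ x with h-onto x
    ... | y , refl = cong h (sym (θ∘h y))

module Involution (n′ : ℕ) {r : ℕ} (b : Fin r → ℕ) (p q : Fin (suc n′))
                  (p≡1+q : toℕ p ≡ suc (toℕ q)) (p∈A : InA b p) (q∉A : ¬ InA b q) where

  N : ℕ
  N = suc n′

  Θ : Set
  Θ = Vec (Fin N) N

  ℓ : Fin N
  ℓ = fromℕ n′

  toℕ-ℓ : toℕ ℓ ≡ n′
  toℕ-ℓ = FP.toℕ-fromℕ n′

  last≡ℓ : ∀ (k : Fin N) → suc (toℕ k) ≡ N → k ≡ ℓ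
  last≡ℓ k e = FP.toℕ-injective (trans (ℕP.suc-injective e) (sym toℕ-ℓ))

  Admissible : Θ → Set
  Admissible θ = ∀ a → InA b a → (∀ k → k F.< a → lookup θ k F.≤ lookup θ a) × (∀ k → a F.< k → lookup θ a F.< lookup θ k)

  HasGap : Θ → Set
  HasGap θ = ∃ λ (i : Fin N) → (i F.< lookup θ ℓ) × (∀ k → lookup θ k ≢ i)

  hasGap? : ∀ θ → Dec (HasGap θ)
  hasGap? θ = FP.any? (λ i → (i FP.<? lookup θ ℓ) ×-dec FP.all? (λ k → ¬? (lookup θ k FP.≟ i)))

  TiedBefore : Θ → Set
  TiedBefore θ = ∃ λ (k : Fin N) → (k F.< p) × (lookup θ k ≡ lookup θ p)

  tiedBefore? : ∀ θ → Dec (TiedBefore θ)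
  tiedBefore? θ = FP.any? (λ k → (k FP.<? p) ×-dec (lookup θ k FP.≟ lookup θ p))

  Covers : Θ → Set
  Covers θ = ∀ i → i F.≤ lookup θ ℓ → ∃ λ k → lookup θ k ≡ i

  raiseAt : (θ : Θ) (k : Fin N) → Dec (k ≡ p) → Dec (lookup θ k F.≤ lookup θ p) → Fin N
  raiseAt θ k (yes _) _ = sucF (lookup θ p)
  raiseAt θ k (no _) (yes _) = lookup θ k
  raiseAt θ k (no _) (no _) = sucF (lookup θ k)

  raise : Θ → Θ
  raise θ = tabulate (λ k → raiseAt θ k (k FP.≟ p) (lookup θ k FP.≤? lookup θ p))

  lowerAt : (θ : Θ) (k : Fin N) → Dec (lookup θ k F.< lookup θ p) → Fin N
  lowerAt θ k (yes _) = lookup θ k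
  lowerAt θ k (no _) = F.pred (lookup θ k)

  lower : Θ → Θ
  lower θ = tabulate (λ k → lowerAt θ k (lookup θ k FP.<? lookup θ p))

  module _ (θ : Θ) where

    private
      t : Fin N → ℕ
      t k = toℕ (lookup θ k)

      raise-at : ∀ k → lookup (raise θ) k ≡ raiseAt θ k (k FP.≟ p) (lookup θ k FP.≤? lookup θ p)
      raise-at = VP.lookup∘tabulate _

      lower-at : ∀ k → lookup (lower θ) k ≡ lowerAt θ k (lookup θ k FP.<? lookup θ p)
      lower-at = VP.lookup∘tabulate _

    toℕ-raise-p : suc (t p) ℕ.< N → toℕ (lookup (raise θ) p) ≡ suc (t p)
    toℕ-raise-p bound rewrite raise-at p with p FP.≟ p
    ... | yes _ = toℕ-sucF _ bound
    ... | no p≢p = ⊥-elim (p≢p refl)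

    toℕ-raise-≤ : ∀ k → k ≢ p → t k ℕ.≤ t p → toℕ (lookup (raise θ) k) ≡ t k
    toℕ-raise-≤ k k≢p tk≤tp rewrite raise-at k with k FP.≟ p | lookup θ k FP.≤? lookup θ p
    ... | yes k≡p | _ = ⊥-elim (k≢p k≡p)
    ... | no _ | yes _ = refl
    ... | no _ | no tk≰tp = ⊥-elim (tk≰tp tk≤tp)

    toℕ-raise-> : ∀ k → k ≢ p → t p ℕ.< t k → suc (t k) ℕ.< N → toℕ (lookup (raise θ) k) ≡ suc (t k)
    toℕ-raise-> k k≢p tp<tk bound rewrite raise-at k with k FP.≟ p | lookup θ k FP.≤? lookup θ p
    ... | yes k≡p | _ = ⊥-elim (k≢p k≡p)
    ... | no _ | yes tk≤tp = ⊥-elim (ℕP.<⇒≱ tp<tk tk≤tp)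
    ... | no _ | no _ = toℕ-sucF _ bound

    toℕ-lower-< : ∀ k → t k ℕ.< t p → toℕ (lookup (lower θ) k) ≡ t k
    toℕ-lower-< k tk<tp rewrite lower-at k with lookup θ k FP.<? lookup θ p
    ... | yes _ = refl
    ... | no tk≮tp = ⊥-elim (tk≮tp tk<tp)

    toℕ-lower-≥ : ∀ k → t p ℕ.≤ t k → toℕ (lookup (lower θ) k) ≡ t k ∸ 1
    toℕ-lower-≥ k tp≤tk rewrite lower-at k with lookup θ k FP.<? lookup θ p
    ... | yes tk<tp = ⊥-elim (ℕP.<⇒≱ tk<tp tp≤tk)
    ... | no _ = toℕ-pred (lookup θ k)

  ιAt : Subset N → (θ : Θ) → Dec (HasGap θ) → Dec (TiedBefore θ) → Subset N × Θ
  ιAt S θ (yes (i , _)) _ = toggle S i , θ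
  ιAt S θ (no _) (yes _) = down (lookup (raise θ) ℓ) , raise θ
  ιAt S θ (no _) (no _) = down (lookup (lower θ) ℓ) , lower θ

  ι : Subset N × Θ → Subset N × Θ
  ι (S , θ) = ιAt S θ (hasGap? θ) (tiedBefore? θ)

  module _ (S : Subset N) (θ : Θ) (c : InC N b (S , θ)) where

    admissible : Admissible θ
    admissible = proj₂ (proj₂ (proj₂ c))

    image⊆S : ∀ k → lookup θ k ∈ S
    image⊆S = proj₁ (proj₂ c)

    θℓ-max : IsMax S (lookup θ ℓ)
    θℓ-max = proj₁ (proj₂ (proj₂ c)) ℓ (cong suc toℕ-ℓ)

    ≤θℓ : ∀ k → lookup θ k F.≤ lookup θ ℓ
    ≤θℓ k = proj₂ θℓ-max (lookup θ k) (image⊆S k)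

  module _ (S : Subset N) (θ : Θ) (c : InC N b (S , θ)) {i : Fin N}
           (i<θℓ : i F.< lookup θ ℓ) (i∉θ : ∀ k → lookup θ k ≢ i) where

    toggle-∈C : InC N b (toggle S i , θ)
    toggle-∈C = (lookup θ ℓ , θℓ∈)
              , (λ k → ∈-toggle (i∉θ k) (image⊆S S θ c k))
              , (λ a a-last → subst (λ z → IsMax (toggle S i) (lookup θ z)) (sym (last≡ℓ a a-last)) (θℓ∈ , below))
              , admissible S θ c
      where
        θℓ∈ : lookup θ ℓ ∈ toggle S i
        θℓ∈ = ∈-toggle (i∉θ ℓ) (image⊆S S θ c ℓ)
        below : ∀ y → y ∈ toggle S i → y F.≤ lookup θ ℓ
        below y y∈ with y FP.≟ i
        ... | yes refl = ℕP.<⇒≤ i<θℓ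
        ... | no y≢i = proj₂ (θℓ-max S θ c) y (∈-toggle⁻ y≢i y∈)

  module _ (S : Subset N) (θ : Θ) (c : InC N b (S , θ)) (no-gap : ¬ HasGap θ) where

    covers : Covers θ
    covers i i≤θℓ with FP.any? (λ k → lookup θ k FP.≟ i)
    ... | yes hit = hit
    ... | no miss with i FP.≟ lookup θ ℓ
    ...   | yes refl = ℓ , refl
    ...   | no i≢θℓ = ⊥-elim (no-gap (i , ℕP.≤∧≢⇒< i≤θℓ (i≢θℓ ∘ FP.toℕ-injective) , λ k e → miss (k , e)))

    S≡down : S ≡ down (lookup θ ℓ)
    S≡down = lookup-≗⇒≡ S _ membership
      where
        membership : ∀ i → lookup S i ≡ lookup (down (lookup θ ℓ)) i
        membership i with i FP.≤? lookup θ ℓ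
        ... | yes i≤θℓ with k , refl ← covers i i≤θℓ =
          trans (VP.[]=⇒lookup (image⊆S S θ c k)) (sym (VP.[]=⇒lookup (∈down i≤θℓ)))
        ... | no i≰θℓ = trans (∉S i≰θℓ) (sym (trans (lookup-down (lookup θ ℓ) i) (dec-false (i FP.≤? lookup θ ℓ) i≰θℓ)))
          where ∉S : ¬ i F.≤ lookup θ ℓ → lookup S i ≡ false
                ∉S i≰θℓ with lookup S i in e
                ... | true = ⊥-elim (i≰θℓ (proj₂ (θℓ-max S θ c) i (VP.lookup⇒[]= i S e)))
                ... | false = refl

  down-∈C : ∀ θ → Admissible θ → (∀ k → lookup θ k F.≤ lookup θ ℓ) → InC N b (down (lookup θ ℓ) , θ)
  down-∈C θ adm ≤θℓ′ = (lookup θ ℓ , ∈down ℕP.≤-refl)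
                     , (λ k → ∈down (≤θℓ′ k))
                     , (λ a a-last → subst (λ z → IsMax (down (lookup θ ℓ)) (lookup θ z)) (sym (last≡ℓ a a-last))
                                            (∈down ℕP.≤-refl , λ y → ∈down⁻))
                     , adm

  -- if θ took every value it would be a bijection, contradicting the tie
  tie⇒θℓ<n′ : ∀ θ → Covers θ → ∀ k → k ≢ p → lookup θ k ≡ lookup θ p → toℕ (lookup θ ℓ) ℕ.< n′
  tie⇒θℓ<n′ θ cov k k≢p tie = ℕP.≤∧≢⇒< (FP.toℕ≤pred[n] (lookup θ ℓ)) θℓ≢n′
    where
      θℓ≢n′ : toℕ (lookup θ ℓ) ≢ n′
      θℓ≢n′ θℓ≡n′ = k≢p (surjective⇒injective (lookup θ) onto tie)
        where onto : ∀ i → ∃ λ k → lookup θ k ≡ i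
              onto i = cov i (subst (toℕ i ℕ.≤_) (sym θℓ≡n′) (FP.toℕ≤pred[n] i))

  module Raise (θ : Θ) (adm : Admissible θ) (≤θℓ : ∀ k → lookup θ k F.≤ lookup θ ℓ) (cov : Covers θ)
               (tied : TiedBefore θ) where

    private
      θ′ : Θ
      θ′ = raise θ

      t t′ : Fin N → ℕ
      t k = toℕ (lookup θ k)
      t′ k = toℕ (lookup θ′ k)

      U : ℕ
      U = t p

      adm-p = adm p p∈A

      k₀ : Fin N
      k₀ = proj₁ tied

      k₀≢p : k₀ ≢ p
      k₀≢p = FP.<⇒≢ (proj₁ (proj₂ tied))

      suc<N : ∀ k → suc (t k) ℕ.< N
      suc<N k = s≤s (ℕP.≤-<-trans (≤θℓ k) (tie⇒θℓ<n′ θ cov k₀ k₀≢p (proj₂ (proj₂ tied))))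

      raise-p : t′ p ≡ suc U
      raise-p = toℕ-raise-p θ (suc<N p)

      raise-≤ : ∀ k → k ≢ p → t k ℕ.≤ U → t′ k ≡ t k
      raise-≤ = toℕ-raise-≤ θ

      raise-> : ∀ k → k ≢ p → U ℕ.< t k → t′ k ≡ suc (t k)
      raise-> k k≢p U<tk = toℕ-raise-> θ k k≢p U<tk (suc<N k)

      raise-≤suc : ∀ k → k ≢ p → t′ k ℕ.≤ suc (t k)
      raise-≤suc k k≢p with t k ℕ.≤? U
      ... | yes tk≤U = ℕP.≤-trans (ℕP.≤-reflexive (raise-≤ k k≢p tk≤U)) (ℕP.n≤1+n (t k))
      ... | no tk≰U = ℕP.≤-reflexive (raise-> k k≢p (ℕP.≰⇒> tk≰U))

    admissible′ : Admissible θ′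
    admissible′ a a∈A = before , after
      where
        adm-a = adm a a∈A
        before : ∀ k → k F.< a → t′ k ℕ.≤ t′ a
        before k k<a with a FP.≟ p | k FP.≟ p
        ... | yes refl | _ = subst (t′ k ℕ.≤_) (sym raise-p)
                (ℕP.≤-trans (ℕP.≤-reflexive (raise-≤ k (FP.<⇒≢ k<a) (proj₁ adm-p k k<a))) (ℕP.m≤n⇒m≤1+n (proj₁ adm-p k k<a)))
        ... | no a≢p | yes refl = subst₂ ℕ._≤_ (sym raise-p) (sym (raise-> a a≢p (proj₂ adm-p a k<a))) (s≤s (ℕP.<⇒≤ (proj₂ adm-p a k<a)))
        ... | no a≢p | no k≢p with t a ℕ.≤? U
        ...   | yes ta≤U = subst₂ ℕ._≤_ (sym (raise-≤ k k≢p (ℕP.≤-trans (proj₁ adm-a k k<a) ta≤U))) (sym (raise-≤ a a≢p ta≤U))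
                                  (proj₁ adm-a k k<a)
        ...   | no ta≰U = subst (t′ k ℕ.≤_) (sym (raise-> a a≢p (ℕP.≰⇒> ta≰U))) (ℕP.≤-trans (raise-≤suc k k≢p) (s≤s (proj₁ adm-a k k<a)))
        after : ∀ k → a F.< k → t′ a ℕ.< t′ k
        after k a<k with a FP.≟ p | k FP.≟ p
        ... | yes refl | yes refl = ⊥-elim (ℕP.<-irrefl refl a<k)
        ... | yes refl | no k≢p = subst₂ ℕ._<_ (sym raise-p) (sym (raise-> k k≢p (proj₂ adm-p k a<k))) (s≤s (proj₂ adm-p k a<k))
        ... | no a≢p | yes refl = subst₂ ℕ._<_ (sym (raise-≤ a a≢p (ℕP.<⇒≤ (proj₂ adm-a p a<k)))) (sym raise-p)
                                         (ℕP.m≤n⇒m≤1+n (proj₂ adm-a p a<k))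
        ... | no a≢p | no k≢p with t k ℕ.≤? U
        ...   | yes tk≤U = subst₂ ℕ._<_ (sym (raise-≤ a a≢p (ℕP.≤-trans (ℕP.<⇒≤ (proj₂ adm-a k a<k)) tk≤U))) (sym (raise-≤ k k≢p tk≤U))
                                  (proj₂ adm-a k a<k)
        ...   | no tk≰U = subst (t′ a ℕ.<_) (sym (raise-> k k≢p (ℕP.≰⇒> tk≰U))) (s≤s (ℕP.≤-trans (raise-≤suc a a≢p) (proj₂ adm-a k a<k)))

    raise-ℓ : t′ ℓ ≡ suc (t ℓ)
    raise-ℓ with p FP.≟ ℓ
    ... | yes refl = raise-p
    ... | no p≢ℓ = raise-> ℓ (p≢ℓ ∘ sym) (proj₂ adm-p ℓ (FP.≤∧≢⇒< (FP.≤fromℕ p) p≢ℓ))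

    ≤θ′ℓ : ∀ k → lookup θ′ k F.≤ lookup θ′ ℓ
    ≤θ′ℓ k with k FP.≟ p
    ... | yes refl = subst₂ ℕ._≤_ (sym raise-p) (sym raise-ℓ) (s≤s (≤θℓ p))
    ... | no k≢p = subst (t′ k ℕ.≤_) (sym raise-ℓ) (ℕP.≤-trans (raise-≤suc k k≢p) (s≤s (≤θℓ k)))

    private
      covered-≤U : ∀ i → toℕ i ℕ.≤ U → ∃ λ k → k ≢ p × lookup θ k ≡ i
      covered-≤U i i≤U with cov i (ℕP.≤-trans i≤U (≤θℓ p))
      ... | k , θk≡i with k FP.≟ p
      ...   | no k≢p = k , k≢p , θk≡i
      ...   | yes refl = k₀ , k₀≢p , trans (proj₂ (proj₂ tied)) θk≡i

      covered->U : ∀ i → suc U ℕ.< toℕ i → toℕ i ℕ.≤ suc (t ℓ) → ∃ λ k → lookup θ′ k ≡ i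
      covered->U i 1+U<i i≤1+θℓ with cov (F.pred i) (subst (ℕ._≤ t ℓ) (sym (toℕ-pred i)) (ℕP.∸-monoˡ-≤ 1 i≤1+θℓ))
      ... | k , θk≡i-1 = k , FP.toℕ-injective (trans (raise-> k k≢p U<tk) (trans (cong suc tk≡i-1) (suc[m∸1]≡m 1≤i)))
        where
          tk≡i-1 : t k ≡ toℕ i ∸ 1
          tk≡i-1 = trans (cong toℕ θk≡i-1) (toℕ-pred i)
          U<tk : U ℕ.< t k
          U<tk = subst (U ℕ.<_) (sym tk≡i-1) (ℕP.∸-monoˡ-< 1+U<i (s≤s z≤n))
          k≢p : k ≢ p
          k≢p k≡p = ℕP.<-irrefl (cong t (sym k≡p)) U<tk
          1≤i : 1 ℕ.≤ toℕ i
          1≤i = ℕP.≤-trans (s≤s z≤n) 1+U<i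

    covers′ : Covers θ′
    covers′ i i≤θ′ℓ with toℕ i ℕ.≤? U
    ... | yes i≤U with k , k≢p , θk≡i ← covered-≤U i i≤U =
      k , FP.toℕ-injective (trans (raise-≤ k k≢p (subst (ℕ._≤ U) (sym (cong toℕ θk≡i)) i≤U)) (cong toℕ θk≡i))
    ... | no i≰U with toℕ i ℕ.≟ suc U
    ...   | yes i≡1+U = p , FP.toℕ-injective (trans raise-p (sym i≡1+U))
    ...   | no i≢1+U = covered->U i (ℕP.≤∧≢⇒< (ℕP.≰⇒> i≰U) (i≢1+U ∘ sym)) (subst (toℕ i ℕ.≤_) raise-ℓ i≤θ′ℓ)

    ¬gap′ : ¬ HasGap θ′
    ¬gap′ (i , i<θ′ℓ , i∉θ′) with k , θ′k≡i ← covers′ i (ℕP.<⇒≤ i<θ′ℓ) = i∉θ′ k θ′k≡i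

    ¬tied′ : ¬ TiedBefore θ′
    ¬tied′ (k , k<p , tie) = ℕP.<-irrefl (trans (sym (raise-≤ k (FP.<⇒≢ k<p) tk≤U)) (trans (cong toℕ tie) raise-p)) (s≤s tk≤U)
      where tk≤U = proj₁ adm-p k k<p

    lower-raise : lower θ′ ≡ θ
    lower-raise = lookup-≗⇒≡ _ _ (λ k → FP.toℕ-injective (restore k))
      where
        restore : ∀ k → toℕ (lookup (lower θ′) k) ≡ t k
        restore k with k FP.≟ p
        ... | yes refl = trans (toℕ-lower-≥ θ′ p ℕP.≤-refl) (cong (_∸ 1) raise-p)
        ... | no k≢p with t k ℕ.≤? U
        ...   | yes tk≤U = trans (toℕ-lower-< θ′ k (subst₂ ℕ._<_ (sym (raise-≤ k k≢p tk≤U)) (sym raise-p) (s≤s tk≤U)))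
                                 (raise-≤ k k≢p tk≤U)
        ...   | no tk≰U = trans (toℕ-lower-≥ θ′ k (subst₂ ℕ._≤_ (sym raise-p) (sym (raise-> k k≢p U<tk)) (s≤s (ℕP.<⇒≤ U<tk))))
                                (cong (_∸ 1) (raise-> k k≢p U<tk))
          where U<tk = ℕP.≰⇒> tk≰U

  module Lower (θ : Θ) (adm : Admissible θ) (≤θℓ : ∀ k → lookup θ k F.≤ lookup θ ℓ) (cov : Covers θ)
               (¬tied : ¬ TiedBefore θ) where

    private
      θ′ : Θ
      θ′ = lower θ

      t t′ : Fin N → ℕ
      t k = toℕ (lookup θ k)
      t′ k = toℕ (lookup θ′ k)

      U : ℕ
      U = t p

      adm-p = adm p p∈A

      q<p : q F.< p
      q<p = subst (toℕ q ℕ.<_) (sym p≡1+q) ℕP.≤-refl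

      tk≢U : ∀ k → k ≢ p → t k ≢ U
      tk≢U k k≢p tk≡U with FP.<-cmp k p
      ... | tri< k<p _ _ = ¬tied (k , k<p , FP.toℕ-injective tk≡U)
      ... | tri≈ _ k≡p _ = k≢p k≡p
      ... | tri> _ _ p<k = ℕP.<-irrefl (sym tk≡U) (proj₂ adm-p k p<k)

      tq<U : t q ℕ.< U
      tq<U = ℕP.≤∧≢⇒< (proj₁ adm-p q q<p) (tk≢U q (FP.<⇒≢ q<p))

      1≤U : 1 ℕ.≤ U
      1≤U = ℕP.≤-trans (s≤s z≤n) tq<U

      lower-< : ∀ k → t k ℕ.< U → t′ k ≡ t k
      lower-< = toℕ-lower-< θ

      lower-≥ : ∀ k → U ℕ.≤ t k → t′ k ≡ t k ∸ 1
      lower-≥ = toℕ-lower-≥ θ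

      lower-p : t′ p ≡ U ∸ 1
      lower-p = lower-≥ p ℕP.≤-refl

      lower-mono : ∀ k k′ → t k ℕ.≤ t k′ → t′ k ℕ.≤ t′ k′
      lower-mono k k′ tk≤tk′ with t k′ ℕ.<? U | t k ℕ.<? U
      ... | yes tk′<U | _ = subst₂ ℕ._≤_ (sym (lower-< k (ℕP.≤-<-trans tk≤tk′ tk′<U))) (sym (lower-< k′ tk′<U)) tk≤tk′
      ... | no tk′≮U | yes tk<U = subst₂ ℕ._≤_ (sym (lower-< k tk<U)) (sym (lower-≥ k′ (ℕP.≮⇒≥ tk′≮U)))
                                         (ℕP.≤-trans (ℕP.∸-monoˡ-≤ 1 tk<U) (ℕP.∸-monoˡ-≤ 1 (ℕP.≮⇒≥ tk′≮U)))
      ... | no tk′≮U | no tk≮U = subst₂ ℕ._≤_ (sym (lower-≥ k (ℕP.≮⇒≥ tk≮U))) (sym (lower-≥ k′ (ℕP.≮⇒≥ tk′≮U)))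
                                        (ℕP.∸-monoˡ-≤ 1 tk≤tk′)

      -- the one place where q ∉ A_b is needed: an a ∈ A_b before p lies before q
      gap-after : ∀ a → InA b a → ∀ k → a F.< k → t a ℕ.< U → U ℕ.≤ t k → suc (t a) ℕ.< t k
      gap-after a a∈A k a<k ta<U U≤tk with k FP.≟ p
      ... | no k≢p = ℕP.<-≤-trans (s≤s ta<U) (ℕP.≤∧≢⇒< U≤tk (tk≢U k k≢p ∘ sym))
      ... | yes refl = ℕP.<-≤-trans (s≤s (proj₂ (adm a a∈A) q a<q)) tq<U
        where
          a≢q : a ≢ q
          a≢q a≡q = q∉A (subst (InA b) a≡q a∈A)
          a<q : a F.< q
          a<q = ℕP.≤∧≢⇒< (ℕP.≤-pred (subst (toℕ a ℕ.<_) p≡1+q a<k)) (a≢q ∘ FP.toℕ-injective)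

    admissible′ : Admissible θ′
    admissible′ a a∈A = (λ k k<a → lower-mono k a (proj₁ adm-a k k<a)) , after
      where
        adm-a = adm a a∈A
        after : ∀ k → a F.< k → t′ a ℕ.< t′ k
        after k a<k with t k ℕ.<? U | t a ℕ.<? U
        ... | yes tk<U | _ = subst₂ ℕ._<_ (sym (lower-< a (ℕP.<-trans (proj₂ adm-a k a<k) tk<U))) (sym (lower-< k tk<U))
                                  (proj₂ adm-a k a<k)
        ... | no tk≮U | no ta≮U = subst₂ ℕ._<_ (sym (lower-≥ a (ℕP.≮⇒≥ ta≮U))) (sym (lower-≥ k (ℕP.≮⇒≥ tk≮U)))
                                         (ℕP.∸-monoˡ-< (proj₂ adm-a k a<k) (ℕP.≤-trans 1≤U (ℕP.≮⇒≥ ta≮U)))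
        ... | no tk≮U | yes ta<U = subst₂ ℕ._<_ (sym (lower-< a ta<U)) (sym (lower-≥ k (ℕP.≮⇒≥ tk≮U)))
                                          (ℕP.∸-monoˡ-< (gap-after a a∈A k a<k ta<U (ℕP.≮⇒≥ tk≮U)) (s≤s z≤n))

    lower-ℓ : suc (t′ ℓ) ≡ t ℓ
    lower-ℓ = trans (cong suc (lower-≥ ℓ (≤θℓ p))) (suc[m∸1]≡m (ℕP.≤-trans 1≤U (≤θℓ p)))

    ≤θ′ℓ : ∀ k → lookup θ′ k F.≤ lookup θ′ ℓ
    ≤θ′ℓ k = lower-mono k ℓ (≤θℓ k)

    private
      covered-≥U : ∀ i → suc (toℕ i) ℕ.≤ t ℓ → U ℕ.≤ suc (toℕ i) → ∃ λ k → lookup θ′ k ≡ i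
      covered-≥U i 1+i≤θℓ U≤1+i = from (cov (sucF i) (subst (ℕ._≤ t ℓ) (sym toℕ-i+1) 1+i≤θℓ))
        where
          toℕ-i+1 : toℕ (sucF i) ≡ suc (toℕ i)
          toℕ-i+1 = toℕ-sucF i (s≤s (ℕP.≤-trans 1+i≤θℓ (FP.toℕ≤pred[n] (lookup θ ℓ))))
          from : (∃ λ k → lookup θ k ≡ sucF i) → ∃ λ k → lookup θ′ k ≡ i
          from (k , θk≡i+1) = k , FP.toℕ-injective (trans (lower-≥ k (subst (U ℕ.≤_) (sym tk≡1+i) U≤1+i)) (cong (_∸ 1) tk≡1+i))
            where tk≡1+i = trans (cong toℕ θk≡i+1) toℕ-i+1

    covers′ : Covers θ′
    covers′ i i≤θ′ℓ with toℕ i ℕ.<? U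
    ... | yes i<U with k , refl ← cov i (ℕP.≤-trans (ℕP.<⇒≤ i<U) (≤θℓ p)) = k , FP.toℕ-injective (lower-< k i<U)
    ... | no i≮U = covered-≥U i (subst (suc (toℕ i) ℕ.≤_) lower-ℓ (s≤s i≤θ′ℓ)) (ℕP.m≤n⇒m≤1+n (ℕP.≮⇒≥ i≮U))

    ¬gap′ : ¬ HasGap θ′
    ¬gap′ (i , i<θ′ℓ , i∉θ′) with k , θ′k≡i ← covers′ i (ℕP.<⇒≤ i<θ′ℓ) = i∉θ′ k θ′k≡i

    -- U - 1 is taken by some k, necessarily before p, which ties with p after lowering
    tied′ : TiedBefore θ′
    tied′ = from (cov (F.pred (lookup θ p)) (subst (ℕ._≤ t ℓ) (sym (toℕ-pred (lookup θ p))) (ℕP.≤-trans (ℕP.m∸n≤m U 1) (≤θℓ p))))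
      where
        from : (∃ λ k → lookup θ k ≡ F.pred (lookup θ p)) → TiedBefore θ′
        from (k , θk≡U-1) = k , k<p (FP.<-cmp k p) , FP.toℕ-injective (trans (lower-< k tk<U) (trans tk≡U-1 (sym lower-p)))
          where
            tk≡U-1 : t k ≡ U ∸ 1
            tk≡U-1 = trans (cong toℕ θk≡U-1) (toℕ-pred (lookup θ p))
            tk<U : t k ℕ.< U
            tk<U = subst (ℕ._< U) (sym tk≡U-1) (ℕP.∸-monoˡ-< {n = 1} (ℕP.n<1+n U) 1≤U)
            k<p : _ → k F.< p
            k<p (tri< k<p _ _) = k<p
            k<p (tri≈ _ k≡p _) = ⊥-elim (ℕP.<-irrefl (cong t k≡p) tk<U)
            k<p (tri> _ _ p<k) = ⊥-elim (ℕP.<-asym tk<U (proj₂ adm-p k p<k))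

    raise-lower : raise θ′ ≡ θ
    raise-lower = lookup-≗⇒≡ _ _ (λ k → FP.toℕ-injective (restore k))
      where
        restore : ∀ k → toℕ (lookup (raise θ′) k) ≡ t k
        restore k with k FP.≟ p
        ... | yes refl = trans (toℕ-raise-p θ′ (subst (ℕ._< N) (sym 1+t′p≡U) (FP.toℕ<n (lookup θ p)))) 1+t′p≡U
          where 1+t′p≡U = trans (cong suc lower-p) (suc[m∸1]≡m 1≤U)
        ... | no k≢p with t k ℕ.<? U
        ...   | yes tk<U = trans (toℕ-raise-≤ θ′ k k≢p (subst₂ ℕ._≤_ (sym (lower-< k tk<U)) (sym lower-p) (ℕP.∸-monoˡ-≤ 1 tk<U)))
                                 (lower-< k tk<U)
        ...   | no tk≮U = trans (toℕ-raise-> θ′ k k≢p (subst₂ ℕ._<_ (sym lower-p) (sym t′k≡tk-1) (ℕP.∸-monoˡ-< U<tk 1≤U))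
                                                   (subst (ℕ._< N) (sym 1+t′k≡tk) (FP.toℕ<n (lookup θ k))))
                                1+t′k≡tk
          where
            U<tk : U ℕ.< t k
            U<tk = ℕP.≤∧≢⇒< (ℕP.≮⇒≥ tk≮U) (tk≢U k k≢p ∘ sym)
            t′k≡tk-1 : t′ k ≡ t k ∸ 1
            t′k≡tk-1 = lower-≥ k (ℕP.≮⇒≥ tk≮U)
            1+t′k≡tk : suc (t′ k) ≡ t k
            1+t′k≡tk = trans (cong suc t′k≡tk-1) (suc[m∸1]≡m (ℕP.≤-trans 1≤U (ℕP.<⇒≤ U<tk)))

  module _ (S : Subset N) (θ : Θ) (c : InC N b (S , θ)) where

    private
      module Raised (no-gap : ¬ HasGap θ) (tied : TiedBefore θ) =
        Raise θ (admissible S θ c) (≤θℓ S θ c) (covers S θ c no-gap) tied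
      module Lowered (no-gap : ¬ HasGap θ) (¬tied : ¬ TiedBefore θ) =
        Lower θ (admissible S θ c) (≤θℓ S θ c) (covers S θ c no-gap) ¬tied

      ιAt-∈C : ∀ gap? tied? → InC N b (ιAt S θ gap? tied?)
      ιAt-∈C (yes (i , i<θℓ , i∉θ)) _ = toggle-∈C S θ c i<θℓ i∉θ
      ιAt-∈C (no no-gap) (yes tied) = down-∈C (raise θ) (Raised.admissible′ no-gap tied) (Raised.≤θ′ℓ no-gap tied)
      ιAt-∈C (no no-gap) (no ¬tied) = down-∈C (lower θ) (Lowered.admissible′ no-gap ¬tied) (Lowered.≤θ′ℓ no-gap ¬tied)

      wt-no-gap : ¬ HasGap θ → wt (S , θ) ≡ sgn (suc (toℕ (lookup θ ℓ)))
      wt-no-gap no-gap = cong sgn (trans (cong ∣_∣ (S≡down S θ c no-gap)) (∣down∣ (lookup θ ℓ)))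

      ιAt-wt : ∀ gap? tied? → wt (ιAt S θ gap? tied?) ≡ - wt (S , θ)
      ιAt-wt (yes (i , _)) _ = sgn-∣toggle∣ S i
      ιAt-wt (no no-gap) (yes tied) =
        trans (cong sgn (trans (∣down∣ (lookup (raise θ) ℓ)) (cong suc (Raised.raise-ℓ no-gap tied)))) (cong -_ (sym (wt-no-gap no-gap)))
      ιAt-wt (no no-gap) (no ¬tied) =
        trans (trans (cong sgn (∣down∣ (lookup (lower θ) ℓ))) (sym (ℤP.neg-involutive _)))
              (cong -_ (sym (trans (wt-no-gap no-gap) (cong (sgn ∘ suc) (sym (Lowered.lower-ℓ no-gap ¬tied))))))

      ιAt-involutive : ∀ gap? tied? → hasGap? θ ≡ gap? → ι (ιAt S θ gap? tied?) ≡ (S , θ)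
      ιAt-involutive (yes (i , _)) _ same-gap =
        trans (cong (λ gap? → ιAt (toggle S i) θ gap? (tiedBefore? θ)) same-gap) (cong (_, θ) (toggle-involutive S i))
      ιAt-involutive (no no-gap) (yes tied) _ = back (hasGap? (raise θ)) (tiedBefore? (raise θ))
        where
          open Raised no-gap tied
          back : ∀ gap? tied? → ιAt (down (lookup (raise θ) ℓ)) (raise θ) gap? tied? ≡ (S , θ)
          back (yes gap) _ = ⊥-elim (¬gap′ gap)
          back (no _) (yes tie) = ⊥-elim (¬tied′ tie)
          back (no _) (no _) = cong₂ _,_ (trans (cong (λ θ′ → down (lookup θ′ ℓ)) lower-raise) (sym (S≡down S θ c no-gap))) lower-raise
      ιAt-involutive (no no-gap) (no ¬tied) _ = back (hasGap? (lower θ)) (tiedBefore? (lower θ))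
        where
          open Lowered no-gap ¬tied
          back : ∀ gap? tied? → ιAt (down (lookup (lower θ) ℓ)) (lower θ) gap? tied? ≡ (S , θ)
          back (yes gap) _ = ⊥-elim (¬gap′ gap)
          back (no _) (yes _) = cong₂ _,_ (trans (cong (λ θ′ → down (lookup θ′ ℓ)) raise-lower) (sym (S≡down S θ c no-gap))) raise-lower
          back (no _) (no ¬tie) = ⊥-elim (¬tie tied′)

    ι-∈C : InC N b (ι (S , θ))
    ι-∈C = ιAt-∈C (hasGap? θ) (tiedBefore? θ)

    ι-wt : wt (ι (S , θ)) ≡ - wt (S , θ)
    ι-wt = ιAt-wt (hasGap? θ) (tiedBefore? θ)

    ι-involutive : ι (ι (S , θ)) ≡ (S , θ)
    ι-involutive = ιAt-involutive (hasGap? θ) (tiedBefore? θ) refl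

  RHS≡0 : RHS N b ≡ + 0
  RHS≡0 = sumWhere-involution≡0 _≟-pair_ (InC? N b) wt ι (λ (S , θ) → ι-∈C S θ) (λ (S , θ) → ι-involutive S θ)
                                (λ (S , θ) → ι-wt S θ) (pairs N) (multiplicity-pairs N)

descent : ∀ {n} {P : Fin (suc n) → Set} → ((k : Fin (suc n)) → Dec (P k)) → P (fromℕ n) → ∀ k → ¬ P k →
          ∃₂ λ p q → toℕ p ≡ suc (toℕ q) × P p × ¬ P q
descent {n} {P} P? P-top k ¬Pk = climb (n ∸ toℕ k) k (ℕP.m∸n+n≡m (FP.toℕ≤pred[n] k)) ¬Pk
  where
    climb : ∀ d k → d ℕ.+ toℕ k ≡ n → ¬ P k → ∃₂ λ p q → toℕ p ≡ suc (toℕ q) × P p × ¬ P q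
    climb zero k k≡top ¬Pk = ⊥-elim (¬Pk (subst P (FP.toℕ-injective (trans (FP.toℕ-fromℕ n) (sym k≡top))) P-top))
    climb (suc d) k e ¬Pk = step (P? k⁺)
      where
        k<n : toℕ k ℕ.< n
        k<n = subst (toℕ k ℕ.<_) e (s≤s (ℕP.m≤n+m (toℕ k) d))
        k⁺ : Fin (suc n)
        k⁺ = fromℕ< (s≤s k<n)
        toℕ-k⁺ : toℕ k⁺ ≡ suc (toℕ k)
        toℕ-k⁺ = FP.toℕ-fromℕ< (s≤s k<n)
        step : Dec (P k⁺) → ∃₂ λ p q → toℕ p ≡ suc (toℕ q) × P p × ¬ P q
        step (yes Pk⁺) = k⁺ , k , toℕ-k⁺ , Pk⁺ , ¬Pk
        step (no ¬Pk⁺) = climb d k⁺ (trans (cong (d ℕ.+_) toℕ-k⁺) (trans (ℕP.+-suc d (toℕ k)) e)) ¬Pk⁺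

last∈A : ∀ {n r} (b : Fin (suc r) → ℕ) → sum (map b (allFin (suc r))) ≡ suc n → InA b (fromℕ n)
last∈A {n} {r} b b-sum = fromℕ r , trans (cong suc (FP.toℕ-fromℕ n)) (sym (trans (cong (sum ∘ map b) everything) b-sum))
  where everything : filter (λ k → k FP.≤? fromℕ r) (allFin (suc r)) ≡ allFin (suc r)
        everything = LP.filter-all (λ k → k FP.≤? fromℕ r) (AllP.tabulate⁺ FP.≤fromℕ)

-- A_b has at most r < n elements, since c is a function of j
some∉A : ∀ {n r} (b : Fin r → ℕ) → r ℕ.< n → ∃ λ (k : Fin n) → ¬ InA b k
some∉A {n} b r<n = FP.¬∀⟶∃¬ n (λ k → InA b k) (λ k → InA? b k) all∈A⇒⊥
  where
    all∈A⇒⊥ : (∀ k → InA b k) → ⊥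
    all∈A⇒⊥ all∈A with FP.pigeonhole r<n (proj₁ ∘ all∈A)
    ... | i , j , i<j , same = FP.<⇒≢ i<j (FP.toℕ-injective (ℕP.suc-injective
                                 (trans (proj₂ (all∈A i)) (trans (cong (c b) same) (sym (proj₂ (all∈A j)))))))

total≤ : ∀ {r} (b : Fin r → ℕ) → (∀ i → b i ℕ.≤ 1) → total b ℕ.≤ r
total≤ {zero} b _ = z≤n
total≤ {suc r} b b≤1 = ℕP.+-mono-≤ (b≤1 fz) (total≤ (b ∘ fs) (b≤1 ∘ fs))

some-part≥2 : ∀ {n r} (b : Fin r → ℕ) → r ℕ.< n → sum (map b (allFin r)) ≡ n → ∃ λ i → 2 ℕ.≤ b i
some-part≥2 {n} {r} b r<n b-sum = map₂ ℕP.≰⇒> (FP.¬∀⟶∃¬ r (λ i → b i ℕ.≤ 1) (λ i → b i ℕ.≤? 1) all≤1⇒⊥)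
  where
    all≤1⇒⊥ : (∀ i → b i ℕ.≤ 1) → ⊥
    all≤1⇒⊥ b≤1 = ℕP.<⇒≱ r<n (subst (ℕ._≤ r) (trans (sym (sum≡total b)) b-sum) (total≤ b b≤1))

RHS≡0 : ∀ n′ {r} (b : Fin (suc r) → ℕ) → suc r ℕ.< suc n′ → sum (map b (allFin (suc r))) ≡ suc n′ → RHS (suc n′) b ≡ + 0
RHS≡0 n′ b r<n b-sum with k , k∉A ← some∉A b r<n
  with p , q , p≡1+q , p∈A , q∉A ← descent (λ k → InA? b k) (last∈A b b-sum) k k∉A =
  Involution.RHS≡0 n′ b p q p≡1+q p∈A q∉A

lemma3 : (n r : ℕ) → 0 < r → r < n → (b : Fin r → ℕ) → (∀ i → 1 ≤ b i) →
         sum (map b (allFin r)) ≡ n →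
         LHS n b ≡ RHS n b
lemma3 (suc n′) (suc r′) _ r<n b b≥1 b-sum =
  trans (LHS≡0 (suc n′) b b≥1 (some-part≥2 b r<n b-sum) b-sum (ℕP.<⇒≤ r<n)) (sym (RHS≡0 n′ b r<n b-sum))
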